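{- For any extended Weihrauch problems $P,Q,R$: if $R\sqcap(P\star Q)\le_W P$, then $R\sqcap(P\star Q^\diamond)\le_W P$; moreover, a pair of functionals witnessing the latter reduction can be computed from a pair witnessing the former.
   Context: Coding: fix a computable tupling $\langle\cdots\rangle$ on Baire space $\mathbb{N}^\mathbb{N}$, computable injections $\mathsf{in}_1,\mathsf{in}_2$ with disjoint decidable images, a computable point $\bullet$, and $\mathcal K_2$-application $c\cdot x$ (the partial continuous function coded by $c$ applied to $x$; "$c\cdot x\in A$" includes definedness). An extended Weihrauch problem $P$ is a set $\mathrm{dom}(P)\subseteq\mathbb{N}^\mathbb{N}$ with, for each $u\in\mathrm{dom}(P)$, a possibly empty set $P(u)\subseteq\mathbb{N}^\mathbb{N}$ of solutions. $P\le_W Q$ iff there are computable partial maps $\varphi,\psi$ with $\varphi(u)\in\mathrm{dom}(Q)$ for all $u\in\mathrm{dom}(P)$ and $\psi(u,y)\in P(u)$ for all $y\in Q(\varphi(u))$. $P\sqcap Q$: instances $\langle u,v\rangle$ ($u\in\mathrm{dom}P$, $v\in\mathrm{dom}Q$), solutions $\{\mathsf{in}_1(x):x\in P(u)\}\cup\{\mathsf{in}_2(y):y\in Q(v)\}$. $P\star Q$: instances $\langle u,c\rangle$ with $u\in\mathrm{dom}(Q)$ and $c\cdot x\in\mathrm{dom}(P)$ for all $x\in Q(u)$, solutions $\{\langle x,y\rangle:x\in Q(u),y\in P(c\cdot x)\}$. $\mathrm{dom}(Q^\diamond)$ is the least set $D$ with $\bullet\in D$ and $\langle u,c\rangle\in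 D$ whenever $u\in\mathrm{dom}(Q)$ and $c\cdot x\in D$ for all $x\in Q(u)$; $Q^\diamond(\bullet)=\{\bullet\}$ and $Q^\diamond(\langle u,c\rangle)=\{\langle x,y\rangle:x\in Q(u),y\in Q^\diamond(c\cdot x)\}$. -}

module Defs where

open import Data.Nat using (ℕ; zero; suc; _+_; _<_)
open import Data.Fin using (Fin)
open import Data.Vec using (Vec; []; _∷_; lookup)
open import Data.List using (List; []; _∷_; applyUpTo)
open import Data.Product using (Σ; _×_; _,_)
open import Data.Sum using (_⊎_)
open import Relation.Binary.PropositionalEquality using (_≡_; _≢_)

Baire : Set
Baire = ℕ → ℕ

_≈_ : Baire → Baire → Set
x ≈ y = ∀ n → x n ≡ y n

data Rec : ℕ → Set where
  zer  : ∀ {n} → Rec n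
  succ : Rec 1
  proj : ∀ {n} → Fin n → Rec n
  comp : ∀ {m n} → Rec m → Vec (Rec n) m → Rec n
  prec : ∀ {n} → Rec n → Rec (suc (suc n)) → Rec (suc n)
  mu   : ∀ {n} → Rec (suc n) → Rec n

mutual
  data Eval : ∀ {n} → Rec n → Vec ℕ n → ℕ → Set where
    e-zer  : ∀ {n} {xs : Vec ℕ n} → Eval zer xs 0
    e-succ : ∀ {x} → Eval succ (x ∷ []) (suc x)
    e-proj : ∀ {n} {i : Fin n} {xs} → Eval (proj i) xs (lookup xs i)
    e-comp : ∀ {m n} {f : Rec m} {gs : Vec (Rec n) m} {xs ys v} →
             EvalAll gs xs ys → Eval f ys v → Eval (comp f gs) xs v
    e-prec0 : ∀ {n} {f : Rec n} {g xs v} →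
              Eval f xs v → Eval (prec f g) (0 ∷ xs) v
    e-precS : ∀ {n} {f : Rec n} {g xs k w v} →
              Eval (prec f g) (k ∷ xs) w → Eval g (k ∷ w ∷ xs) v →
              Eval (prec f g) (suc k ∷ xs) v
    e-mu   : ∀ {n} {f : Rec (suc n)} {xs k} →
             Eval f (k ∷ xs) 0 →
             (∀ j → j < k → Σ ℕ λ v → Eval f (j ∷ xs) (suc v)) →
             Eval (mu f) xs k

  data EvalAll {n} : ∀ {m} → Vec (Rec n) m → Vec ℕ n → Vec ℕ m → Set where
    ea-[] : ∀ {xs} → EvalAll [] xs []
    ea-∷  : ∀ {m} {g} {gs : Vec (Rec n) m} {xs y ys} →
            Eval g xs y → EvalAll gs xs ys → EvalAll (g ∷ gs) xs (y ∷ ys)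

Computable : Baire → Set
Computable c = Σ (Rec 1) λ t → ∀ n → Eval t (n ∷ []) (c n)

tri : ℕ → ℕ
tri zero    = zero
tri (suc k) = suc k + tri k

pairℕ : ℕ → ℕ → ℕ
pairℕ m n = tri (m + n) + n

encList : List ℕ → ℕ
encList []       = 0
encList (x ∷ xs) = suc (pairℕ x (encList xs))

-- Kleene's second algebra K₂:
-- (c · x)(n) = c ⟨n , x̄k⟩ - 1 for the least k with c ⟨n , x̄k⟩ > 0.
-- App c x y  means  "c · x is defined and equals y".

App : Baire → Baire → Baire → Set
App c x y = ∀ n → Σ ℕ λ k →
  (c (pairℕ n (encList (applyUpTo x k))) ≡ suc (y n)) ×
  (∀ j → j < k → c (pairℕ n (encList (applyUpTo x j))) ≡ 0)

_·_∈_ : Baire → Baire → (Baire → Set) → Set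
c · x ∈ A = Σ Baire λ y → App c x y × A y

-- ⟨x , y⟩ = 1 , x 0 , y 0 , x 1 , y 1 , ...
⟨_,_⟩ : Baire → Baire → Baire
⟨ x , y ⟩ zero                = 1
⟨ x , y ⟩ (suc zero)          = x 0
⟨ x , y ⟩ (suc (suc zero))    = y 0
⟨ x , y ⟩ (suc (suc (suc n))) = ⟨ (λ k → x (suc k)) , (λ k → y (suc k)) ⟩ (suc n)

π₁ : Baire → Baire
π₁ w n = w (suc (n + n))

π₂ : Baire → Baire
π₂ w n = w (suc (suc (n + n)))

in₁ : Baire → Baire
in₁ x zero    = 0
in₁ x (suc n) = x n

in₂ : Baire → Baire
in₂ x zero    = 1
in₂ x (suc n) = x n

-- the point • (not in the image of the tupling, since ⟨x,y⟩ 0 = 1)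
• : Baire
• _ = 0

record Problem : Set₁ where
  field
    dom : Baire → Set
    sol : Baire → Baire → Set
open Problem public

-- P(u) and dom(P) are *sets* of points: membership respects equality of points
IsExt : Problem → Set
IsExt P = (∀ {u u'} → u ≈ u' → dom P u → dom P u') ×
          (∀ {u u' y y'} → u ≈ u' → y ≈ y' → sol P u y → sol P u' y')

_⊓_ : Problem → Problem → Problem
dom (P ⊓ Q) w = (w 0 ≡ 1) × dom P (π₁ w) × dom Q (π₂ w)
sol (P ⊓ Q) w z =
  (Σ Baire λ x → (z ≈ in₁ x) × sol P (π₁ w) x) ⊎
  (Σ Baire λ y → (z ≈ in₂ y) × sol Q (π₂ w) y)

_⋆_ : Problem → Problem → Problem
dom (P ⋆ Q) w = (w 0 ≡ 1) × dom Q (π₁ w) ×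
                (∀ x → sol Q (π₁ w) x → π₂ w · x ∈ dom P)
sol (P ⋆ Q) w z = Σ Baire λ x → Σ Baire λ y → (z ≈ ⟨ x , y ⟩) ×
  sol Q (π₁ w) x × (Σ Baire λ v → App (π₂ w) x v × sol P v y)

data DomD (Q : Problem) : Baire → Set where
  d• : ∀ {w} → w ≈ • → DomD Q w
  dstep : ∀ {w} → w 0 ≡ 1 → dom Q (π₁ w) →
          (∀ x → sol Q (π₁ w) x → Σ Baire λ v → App (π₂ w) x v × DomD Q v) →
          DomD Q w

data SolD (Q : Problem) : Baire → Baire → Set where
  s• : ∀ {w z} → w ≈ • → z ≈ • → SolD Q w z
  sstep : ∀ {w z x v y} → w 0 ≡ 1 → sol Q (π₁ w) x → App (π₂ w) x v →
          SolD Q v y → z ≈ ⟨ x , y ⟩ → SolD Q w z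

_◇ : Problem → Problem
dom (Q ◇) = DomD Q
sol (Q ◇) = SolD Q

-- (a , b) witnesses P ≤W Q via φ(u) = a · u, ψ(u , y) = b · ⟨u , y⟩
Witnesses : Problem → Problem → Baire → Baire → Set
Witnesses P Q a b =
  (∀ u → dom P u → a · u ∈ dom Q) ×
  (∀ u → dom P u → ∀ v → App a u v → ∀ y → sol Q v y →
     b · ⟨ u , y ⟩ ∈ sol P u)

_≤W_ : Problem → Problem → Set
P ≤W Q = Σ Baire λ a → Σ Baire λ b →
  Computable a × Computable b × Witnesses P Q a b

{-# OPTIONS --safe #-}
-- An instance of R ⊓ (P ⋆ Q◇) is an instance of R together with a well-founded tree of Q-instances
-- whose branches end in instances of P. From a reduction (a , b) of R ⊓ (P ⋆ Q) to P, a reduction of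
-- R ⊓ (P ⋆ Q◇) is defined by recursion on the tree: at a leaf • the P-instance is solved directly; at a
-- node ⟨ u , d ⟩ the forward map hands to a the instance ⟨ r , ⟨ u , e ⟩ ⟩ of R ⊓ (P ⋆ Q), where e sends
-- each solution x of Q(u) to the P-instance obtained recursively from the subtree d · x. An answer of b is
-- either a solution of R, or a solution x of Q(u) with a solution for the subtree, which is translated back
-- recursively. The recursion is carried out inside Kleene's
-- second algebra K₂: codes of S and K are built from μ-recursive functions, bracket abstraction turns terms
-- into codes, and self-application gives fixed points. Every step is uniform in ⟨ a , b ⟩, so a single
-- computable code maps ⟨ a , b ⟩ to the new pair of codes.

module Submission where

open import Defs
open import Data.Nat hiding (_⊓_)
open import Data.Nat using () renaming (_⊓_ to _⊓ℕ_)
open import Data.Nat.Properties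
open import Data.Fin using (Fin; zero; suc)
open import Data.Vec using (Vec; []; _∷_; lookup; tabulate)
open import Data.Vec.Properties using (tabulate∘lookup)
open import Data.List using (List; []; _∷_; applyUpTo; length; drop)
open import Data.List.Properties using (length-applyUpTo; length-drop)
open import Data.Product using (Σ; _×_; _,_; proj₁; proj₂)
open import Data.Sum using (_⊎_; inj₁; inj₂)
open import Data.Empty using (⊥-elim)
open import Function using (const)
open import Relation.Nullary using (yes; no)
open import Relation.Binary.PropositionalEquality
open import Relation.Binary.Definitions using (tri<; tri≈; tri>)

record Recursive (n : ℕ) (f : Vec ℕ n → ℕ) : Set where
  constructor recursive
  field
    term     : Rec n
    computes : ∀ xs → Eval term xs (f xs)

record RecursiveVec (n m : ℕ) (fs : Vec ℕ n → Vec ℕ m) : Set where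
  constructor recursiveVec
  field
    terms       : Vec (Rec n) m
    computesAll : ∀ xs → EvalAll terms xs (fs xs)

[]ᴿ : ∀ {n} → RecursiveVec n 0 (λ _ → [])
[]ᴿ = recursiveVec [] (λ _ → ea-[])

infixr 5 _∷ᴿ_
_∷ᴿ_ : ∀ {n m f fs} → Recursive n f → RecursiveVec n m fs → RecursiveVec n (suc m) (λ xs → f xs ∷ fs xs)
recursive t ok ∷ᴿ recursiveVec ts oks = recursiveVec (t ∷ ts) (λ xs → ea-∷ (ok xs) (oks xs))

recursive-ext : ∀ {n f g} → Recursive n f → (∀ xs → f xs ≡ g xs) → Recursive n g
recursive-ext (recursive t ok) f≗g = recursive t (λ xs → subst (Eval t xs) (f≗g xs) (ok xs))

zeroᴿ : ∀ {n} → Recursive n (λ _ → 0)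
zeroᴿ = recursive zer (λ _ → e-zer)

projᴿ : ∀ {n} (i : Fin n) → Recursive n (λ xs → lookup xs i)
projᴿ i = recursive (proj i) (λ _ → e-proj)

compᴿ : ∀ {n m f fs} → Recursive m f → RecursiveVec n m fs → Recursive n (λ xs → f (fs xs))
compᴿ (recursive t ok) (recursiveVec ts oks) = recursive (comp t ts) (λ xs → e-comp (oks xs) (ok _))

sucᴿ : ∀ {n f} → Recursive n f → Recursive n (λ xs → suc (f xs))
sucᴿ F = compᴿ {f = λ xs → suc (lookup xs zero)} (recursive succ λ { (x ∷ []) → e-succ }) (F ∷ᴿ []ᴿ)

primRec : ∀ {n} → (Vec ℕ n → ℕ) → (Vec ℕ (2 + n) → ℕ) → Vec ℕ (suc n) → ℕ
primRec f g (zero  ∷ xs) = f xs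
primRec f g (suc k ∷ xs) = g (k ∷ primRec f g (k ∷ xs) ∷ xs)

precᴿ : ∀ {n f g} → Recursive n f → Recursive (2 + n) g → Recursive (suc n) (primRec f g)
precᴿ {n} {f} {g} (recursive t ok) (recursive u ok′) = recursive (prec t u) eval
  where
  eval : ∀ xs → Eval (prec t u) xs (primRec f g xs)
  eval (zero  ∷ xs) = e-prec0 (ok xs)
  eval (suc k ∷ xs) = e-precS (eval (k ∷ xs)) (ok′ _)

μᴿ : ∀ {n f} → Recursive (suc n) f → (h : Vec ℕ n → ℕ) →
     (∀ xs → f (h xs ∷ xs) ≡ 0) → (∀ xs j → j < h xs → 0 < f (j ∷ xs)) → Recursive n h
μᴿ {n} {f} (recursive t ok) h root below =
  recursive (mu t) (λ xs → e-mu (subst (Eval t _) (root xs) (ok _)) (λ j j< → positive xs j (below xs j j<)))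
  where
  positive : ∀ xs j → 0 < f (j ∷ xs) → Σ ℕ λ v → Eval t (j ∷ xs) (suc v)
  positive xs j _ with f (j ∷ xs) | ok (j ∷ xs)
  ... | suc v | e = v , e

-- The record types let Agda infer f from a realisation.

record Recursive₁ (f : ℕ → ℕ) : Set where
  constructor mk₁
  field realise₁ : Recursive 1 (λ xs → f (lookup xs zero))

record Recursive₂ (f : ℕ → ℕ → ℕ) : Set where
  constructor mk₂
  field realise₂ : Recursive 2 (λ xs → f (lookup xs zero) (lookup xs (suc zero)))

record Recursive₃ (f : ℕ → ℕ → ℕ → ℕ) : Set where
  constructor mk₃
  field realise₃ : Recursive 3 (λ xs → f (lookup xs zero) (lookup xs (suc zero)) (lookup xs (suc (suc zero))))

record Recursive₄ (f : ℕ → ℕ → ℕ → ℕ → ℕ) : Set where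
  constructor mk₄
  field realise₄ : Recursive 4 (λ xs → f (lookup xs zero) (lookup xs (suc zero))
                                          (lookup xs (suc (suc zero))) (lookup xs (suc (suc (suc zero)))))

call₁ : ∀ {n g} {f : ℕ → ℕ} → Recursive₁ f → Recursive n g → Recursive n (λ xs → f (g xs))
call₁ (mk₁ F) G = compᴿ F (G ∷ᴿ []ᴿ)

call₂ : ∀ {n g h} {f : ℕ → ℕ → ℕ} → Recursive₂ f → Recursive n g → Recursive n h →
        Recursive n (λ xs → f (g xs) (h xs))
call₂ (mk₂ F) G H = compᴿ F (G ∷ᴿ H ∷ᴿ []ᴿ)

call₃ : ∀ {n g h k} {f : ℕ → ℕ → ℕ → ℕ} → Recursive₃ f → Recursive n g → Recursive n h → Recursive n k →
        Recursive n (λ xs → f (g xs) (h xs) (k xs))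
call₃ (mk₃ F) G H K = compᴿ F (G ∷ᴿ H ∷ᴿ K ∷ᴿ []ᴿ)

call₄ : ∀ {n g h k l} {f : ℕ → ℕ → ℕ → ℕ → ℕ} → Recursive₄ f →
        Recursive n g → Recursive n h → Recursive n k → Recursive n l →
        Recursive n (λ xs → f (g xs) (h xs) (k xs) (l xs))
call₄ (mk₄ F) G H K L = compᴿ F (G ∷ᴿ H ∷ᴿ K ∷ᴿ L ∷ᴿ []ᴿ)

recursive₁-ext : ∀ {f g} → Recursive₁ f → (∀ x → f x ≡ g x) → Recursive₁ g
recursive₁-ext (mk₁ F) f≗g = mk₁ (recursive-ext F (λ { (x ∷ []) → f≗g x }))

recursive₂-ext : ∀ {f g} → Recursive₂ f → (∀ x y → f x y ≡ g x y) → Recursive₂ g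
recursive₂-ext (mk₂ F) f≗g = mk₂ (recursive-ext F (λ { (x ∷ y ∷ []) → f≗g x y }))

arg₀ : ∀ {n} → Recursive (1 + n) (λ xs → lookup xs zero)
arg₀ = projᴿ zero
arg₁ : ∀ {n} → Recursive (2 + n) (λ xs → lookup xs (suc zero))
arg₁ = projᴿ (suc zero)
arg₂ : ∀ {n} → Recursive (3 + n) (λ xs → lookup xs (suc (suc zero)))
arg₂ = projᴿ (suc (suc zero))
arg₃ : ∀ {n} → Recursive (4 + n) (λ xs → lookup xs (suc (suc (suc zero))))
arg₃ = projᴿ (suc (suc (suc zero)))
arg₄ : ∀ {n} → Recursive (5 + n) (λ xs → lookup xs (suc (suc (suc (suc zero)))))
arg₄ = projᴿ (suc (suc (suc (suc zero))))

constᴿ : ∀ {n} (c : ℕ) → Recursive n (λ _ → c)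
constᴿ zero    = zeroᴿ
constᴿ (suc c) = sucᴿ (constᴿ c)

primRec₀ : ℕ → (ℕ → ℕ → ℕ) → ℕ → ℕ
primRec₀ a b zero    = a
primRec₀ a b (suc k) = b k (primRec₀ a b k)

primRec₁ : (ℕ → ℕ) → (ℕ → ℕ → ℕ → ℕ) → ℕ → ℕ → ℕ
primRec₁ a b zero    y = a y
primRec₁ a b (suc k) y = b k (primRec₁ a b k y) y

primRec₀ᴿ : ∀ {a b} → Recursive₂ b → Recursive₁ (primRec₀ a b)
primRec₀ᴿ {a} {b} (mk₂ B) = mk₁ (recursive-ext (precᴿ (constᴿ a) B) unfold)
  where
  unfold : ∀ xs → primRec _ _ xs ≡ primRec₀ a b (lookup xs zero)
  unfold (zero  ∷ []) = refl
  unfold (suc k ∷ []) = cong (b k) (unfold (k ∷ []))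

primRec₁ᴿ : ∀ {a b} → Recursive₁ a → Recursive₃ b → Recursive₂ (primRec₁ a b)
primRec₁ᴿ {a} {b} (mk₁ A) (mk₃ B) = mk₂ (recursive-ext (precᴿ A B) unfold)
  where
  unfold : ∀ xs → primRec _ _ xs ≡ primRec₁ a b (lookup xs zero) (lookup xs (suc zero))
  unfold (zero  ∷ y ∷ []) = refl
  unfold (suc k ∷ y ∷ []) = cong (λ r → b k r y) (unfold (k ∷ y ∷ []))

+ᴿ : Recursive₂ _+_
+ᴿ = recursive₂-ext (primRec₁ᴿ {b = λ _ r _ → suc r} (mk₁ arg₀) (mk₃ (sucᴿ arg₁))) primRec₁≡+
  where
  primRec₁≡+ : ∀ x y → primRec₁ (λ y → y) (λ _ r _ → suc r) x y ≡ x + y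
  primRec₁≡+ zero    y = refl
  primRec₁≡+ (suc x) y = cong suc (primRec₁≡+ x y)

predᴿ : Recursive₁ pred
predᴿ = recursive₁-ext (primRec₀ᴿ {a = 0} {b = λ k _ → k} (mk₂ arg₀)) λ { zero → refl ; (suc _) → refl }

∸ᴿ : Recursive₂ _∸_
∸ᴿ = recursive₂-ext (mk₂ (call₂ (primRec₁ᴿ {b = λ _ r _ → pred r} (mk₁ arg₀) (mk₃ (call₁ predᴿ arg₁))) arg₁ arg₀))
       (λ x y → primRec₁≡∸ y x)
  where
  primRec₁≡∸ : ∀ y x → primRec₁ (λ x → x) (λ _ r _ → pred r) y x ≡ x ∸ y
  primRec₁≡∸ zero    x = refl
  primRec₁≡∸ (suc y) x = trans (cong pred (primRec₁≡∸ y x)) (pred[m∸n]≡m∸[1+n] x y)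

ifz : ℕ → ℕ → ℕ → ℕ
ifz zero    a b = a
ifz (suc _) a b = b

ifzᴿ : Recursive₃ ifz
ifzᴿ = mk₃ (recursive-ext (precᴿ arg₀ arg₃) λ { (zero ∷ _ ∷ _ ∷ []) → refl ; (suc _ ∷ _ ∷ _ ∷ []) → refl })

∸+∸≡∣-∣ : ∀ m n → (m ∸ n) + (n ∸ m) ≡ ∣ m - n ∣
∸+∸≡∣-∣ m n with ≤-total m n
... | inj₁ m≤n = trans (cong (_+ (n ∸ m)) (m≤n⇒m∸n≡0 m≤n)) (sym (m≤n⇒∣m-n∣≡n∸m m≤n))
... | inj₂ n≤m = trans (cong ((m ∸ n) +_) (m≤n⇒m∸n≡0 n≤m)) (trans (+-identityʳ _) (sym (m≤n⇒∣n-m∣≡n∸m n≤m)))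

∣-∣ᴿ : Recursive₂ ∣_-_∣
∣-∣ᴿ = recursive₂-ext (mk₂ (call₂ +ᴿ (call₂ ∸ᴿ arg₀ arg₁) (call₂ ∸ᴿ arg₁ arg₀))) ∸+∸≡∣-∣

+∸≡⊔ : ∀ m n → m + (n ∸ m) ≡ m ⊔ n
+∸≡⊔ m n with ≤-total m n
... | inj₁ m≤n = trans (m+[n∸m]≡n m≤n) (sym (m≤n⇒m⊔n≡n m≤n))
... | inj₂ n≤m = trans (cong (m +_) (m≤n⇒m∸n≡0 n≤m)) (trans (+-identityʳ m) (sym (m≥n⇒m⊔n≡m n≤m)))

⊔ᴿ : Recursive₂ _⊔_
⊔ᴿ = recursive₂-ext (mk₂ (call₂ +ᴿ arg₀ (call₂ ∸ᴿ arg₁ arg₀))) +∸≡⊔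

next : ℕ × ℕ → ℕ × ℕ
next (zero  , n) = suc n , 0
next (suc m , n) = m , suc n

unpair : ℕ → ℕ × ℕ
unpair zero    = 0 , 0
unpair (suc w) = next (unpair w)

fstℕ sndℕ : ℕ → ℕ
fstℕ w = proj₁ (unpair w)
sndℕ w = proj₂ (unpair w)

pairℕ-suc-snd : ∀ m n → pairℕ m (suc n) ≡ suc (pairℕ (suc m) n)
pairℕ-suc-snd m n = begin
  tri (m + suc n) + suc n   ≡⟨ cong (λ t → tri t + suc n) (+-suc m n) ⟩
  tri (suc m + n) + suc n   ≡⟨ +-suc _ n ⟩
  suc (tri (suc m + n) + n) ∎
  where open ≡-Reasoning

pairℕ-suc-zero : ∀ m → pairℕ (suc m) 0 ≡ suc (pairℕ 0 m)
pairℕ-suc-zero m = begin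
  tri (suc m + 0) + 0 ≡⟨ +-identityʳ _ ⟩
  tri (suc m + 0)     ≡⟨ cong tri (+-identityʳ (suc m)) ⟩
  suc (m + tri m)     ≡⟨ cong suc (+-comm m (tri m)) ⟩
  suc (tri m + m)     ∎
  where open ≡-Reasoning

pairℕ-unpair : ∀ w → pairℕ (fstℕ w) (sndℕ w) ≡ w
pairℕ-unpair zero = refl
pairℕ-unpair (suc w) with unpair w | pairℕ-unpair w
... | zero  , n | eq = trans (pairℕ-suc-zero n) (cong suc eq)
... | suc m , n | eq = trans (pairℕ-suc-snd m n) (cong suc eq)

unpair-pairℕ : ∀ m n → unpair (pairℕ m n) ≡ (m , n)
unpair-pairℕ m n = onDiagonal (m + n) m n refl
  where
  onDiagonal : ∀ d m n → m + n ≡ d → unpair (pairℕ m n) ≡ (m , n)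
  onDiagonal d       zero    zero    _  = refl
  onDiagonal d       m       (suc n) eq =
    trans (cong unpair (pairℕ-suc-snd m n)) (cong next (onDiagonal d (suc m) n (trans (sym (+-suc m n)) eq)))
  onDiagonal (suc d) (suc m) zero    eq =
    trans (cong unpair (pairℕ-suc-zero m)) (cong next (onDiagonal d zero m (suc-injective (trans (sym (cong suc (+-identityʳ m))) eq))))

fstℕ-pairℕ : ∀ m n → fstℕ (pairℕ m n) ≡ m
fstℕ-pairℕ m n = cong proj₁ (unpair-pairℕ m n)

sndℕ-pairℕ : ∀ m n → sndℕ (pairℕ m n) ≡ n
sndℕ-pairℕ m n = cong proj₂ (unpair-pairℕ m n)

tri-mono-≤ : ∀ {a b} → a ≤ b → tri a ≤ tri b
tri-mono-≤ {zero}  _         = z≤n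
tri-mono-≤ {suc a} (s≤s a≤b) = +-mono-≤ (s≤s a≤b) (tri-mono-≤ a≤b)

pairℕ-mono-≤ : ∀ {m m′ n n′} → m ≤ m′ → n ≤ n′ → pairℕ m n ≤ pairℕ m′ n′
pairℕ-mono-≤ m≤m′ n≤n′ = +-mono-≤ (tri-mono-≤ (+-mono-≤ m≤m′ n≤n′)) n≤n′

n≤pairℕ : ∀ m n → n ≤ pairℕ m n
n≤pairℕ m n = m≤n+m n (tri (m + n))

triᴿ : Recursive₁ tri
triᴿ = recursive₁-ext (primRec₀ᴿ {a = 0} {b = λ k r → suc k + r} (mk₂ (call₂ +ᴿ (sucᴿ arg₀) arg₁))) primRec₀≡tri
  where
  primRec₀≡tri : ∀ k → primRec₀ 0 (λ k r → suc k + r) k ≡ tri k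
  primRec₀≡tri zero    = refl
  primRec₀≡tri (suc k) = cong (suc k +_) (primRec₀≡tri k)

pairᴿ : Recursive₂ pairℕ
pairᴿ = mk₂ (call₂ +ᴿ (call₁ triᴿ (call₂ +ᴿ arg₀ arg₁)) arg₁)

-- Unpairing is recursive because the diagonal of w is the least d with w < tri (suc d).

diagonal : ℕ → ℕ
diagonal w = fstℕ w + sndℕ w

tri-diagonal-≤ : ∀ w → tri (diagonal w) ≤ w
tri-diagonal-≤ w = subst (tri (diagonal w) ≤_) (pairℕ-unpair w) (m≤m+n _ _)

<-tri-suc-diagonal : ∀ w → w < tri (suc (diagonal w))
<-tri-suc-diagonal w = subst (_< tri (suc (diagonal w))) (pairℕ-unpair w) (begin-strict
  tri (diagonal w) + sndℕ w       <⟨ +-monoʳ-< (tri (diagonal w)) (s≤s (m≤n+m (sndℕ w) (fstℕ w))) ⟩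
  tri (diagonal w) + suc (diagonal w) ≡⟨ +-comm (tri (diagonal w)) _ ⟩
  tri (suc (diagonal w))          ∎)
  where open ≤-Reasoning

diagonalᴿ : Recursive₁ diagonal
diagonalᴿ = mk₁ (μᴿ {f = λ xs → suc (lookup xs (suc zero)) ∸ tri (suc (lookup xs zero))}
  (call₂ ∸ᴿ (sucᴿ arg₁) (call₁ triᴿ (sucᴿ arg₀)))
  (λ xs → diagonal (lookup xs zero))
  (λ { (w ∷ []) → m≤n⇒m∸n≡0 (<-tri-suc-diagonal w) })
  (λ { (w ∷ []) j j< → m<n⇒0<n∸m (s≤s (≤-trans (tri-mono-≤ j<) (tri-diagonal-≤ w))) }))

sndᴿ : Recursive₁ sndℕ
sndᴿ = recursive₁-ext (mk₁ (call₂ ∸ᴿ arg₀ (call₁ triᴿ (call₁ diagonalᴿ arg₀)))) sndℕ-via-diagonal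
  where
  sndℕ-via-diagonal : ∀ w → w ∸ tri (diagonal w) ≡ sndℕ w
  sndℕ-via-diagonal w =
    trans (cong (_∸ tri (diagonal w)) (sym (pairℕ-unpair w))) (m+n∸m≡n (tri (diagonal w)) (sndℕ w))

fstᴿ : Recursive₁ fstℕ
fstᴿ = recursive₁-ext (mk₁ (call₂ ∸ᴿ (call₁ diagonalᴿ arg₀) (call₁ sndᴿ arg₀))) (λ w → m+n∸n≡m (fstℕ w) (sndℕ w))

consℕ : ℕ → ℕ → ℕ
consℕ x c = suc (pairℕ x c)

headℕ tailℕ : ℕ → ℕ
headℕ c = fstℕ (pred c)
tailℕ c = sndℕ (pred c)

dropℕ : ℕ → ℕ → ℕ
dropℕ zero    c = c
dropℕ (suc i) c = tailℕ (dropℕ i c)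

lookupℕ : ℕ → ℕ → ℕ
lookupℕ i c = headℕ (dropℕ i c)

entries : ℕ → Baire
entries c i = lookupℕ i c

consᴿ : Recursive₂ consℕ
consᴿ = mk₂ (sucᴿ (call₂ pairᴿ arg₀ arg₁))

tailᴿ : Recursive₁ tailℕ
tailᴿ = mk₁ (call₁ sndᴿ (call₁ predᴿ arg₀))

dropᴿ : Recursive₂ dropℕ
dropᴿ = recursive₂-ext (primRec₁ᴿ {b = λ _ r _ → tailℕ r} (mk₁ arg₀) (mk₃ (call₁ tailᴿ arg₁)))
          primRec₁≡dropℕ
  where
  primRec₁≡dropℕ : ∀ i c → primRec₁ (λ c → c) (λ _ r _ → tailℕ r) i c ≡ dropℕ i c
  primRec₁≡dropℕ zero    c = refl
  primRec₁≡dropℕ (suc i) c = cong tailℕ (primRec₁≡dropℕ i c)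

lookupᴿ : Recursive₂ lookupℕ
lookupᴿ = mk₂ (call₁ fstᴿ (call₁ predᴿ (call₂ dropᴿ arg₀ arg₁)))

nth : List ℕ → ℕ → ℕ
nth []       i       = 0
nth (x ∷ xs) zero    = x
nth (x ∷ xs) (suc i) = nth xs i

dropℕ-encList : ∀ i xs → dropℕ i (encList xs) ≡ encList (drop i xs)
dropℕ-encList zero    xs = refl
dropℕ-encList (suc i) xs = trans (cong tailℕ (dropℕ-encList i xs)) (tail-drop i xs)
  where
  tail-drop : ∀ i xs → tailℕ (encList (drop i xs)) ≡ encList (drop (suc i) xs)
  tail-drop zero    []       = refl
  tail-drop zero    (x ∷ xs) = sndℕ-pairℕ x (encList xs)
  tail-drop (suc i) []       = refl
  tail-drop (suc i) (x ∷ xs) = tail-drop i xs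

lookupℕ-encList : ∀ i xs → lookupℕ i (encList xs) ≡ nth xs i
lookupℕ-encList i xs = trans (cong headℕ (dropℕ-encList i xs)) (head-drop i xs)
  where
  head-drop : ∀ i xs → headℕ (encList (drop i xs)) ≡ nth xs i
  head-drop zero    []       = refl
  head-drop zero    (x ∷ xs) = fstℕ-pairℕ x (encList xs)
  head-drop (suc i) []       = refl
  head-drop (suc i) (x ∷ xs) = head-drop i xs

lengthUpTo : ℕ → ℕ → ℕ
lengthUpTo zero    c = 0
lengthUpTo (suc k) c = ifz (dropℕ k c) (lengthUpTo k c) (suc (lengthUpTo k c))

lengthℕ : ℕ → ℕ
lengthℕ c = lengthUpTo c c

lengthᴿ : Recursive₁ lengthℕ
lengthᴿ = mk₁ (call₂ lengthUpToᴿ arg₀ arg₀)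
  where
  step : ℕ → ℕ → ℕ → ℕ
  step k r c = ifz (dropℕ k c) r (suc r)
  primRec₁≡lengthUpTo : ∀ k c → primRec₁ (λ _ → 0) step k c ≡ lengthUpTo k c
  primRec₁≡lengthUpTo zero    c = refl
  primRec₁≡lengthUpTo (suc k) c = cong (λ r → step k r c) (primRec₁≡lengthUpTo k c)
  lengthUpToᴿ : Recursive₂ lengthUpTo
  lengthUpToᴿ = recursive₂-ext
    (primRec₁ᴿ (mk₁ zeroᴿ) (mk₃ (call₃ ifzᴿ (call₂ dropᴿ arg₀ arg₂) arg₁ (sucᴿ arg₁)))) primRec₁≡lengthUpTo

length≤encList : ∀ xs → length xs ≤ encList xs
length≤encList []       = z≤n
length≤encList (x ∷ xs) = s≤s (≤-trans (length≤encList xs) (n≤pairℕ x (encList xs)))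

lengthUpTo-encList : ∀ k xs → lengthUpTo k (encList xs) ≡ k ⊓ℕ length xs
lengthUpTo-encList zero    xs = refl
lengthUpTo-encList (suc k) xs rewrite lengthUpTo-encList k xs | dropℕ-encList k xs
  with drop k xs | length-drop k xs
... | []    | len∸k≡0 = trans (m≥n⇒m⊓n≡n len≤k) (sym (m≥n⇒m⊓n≡n (m≤n⇒m≤1+n len≤k)))
  where
  len≤k : length xs ≤ k
  len≤k = m∸n≡0⇒m≤n (sym len∸k≡0)
... | _ ∷ _ | len∸k≡suc = trans (cong suc (m≤n⇒m⊓n≡m (<⇒≤ k<len))) (sym (m≤n⇒m⊓n≡m k<len))
  where
  k<len : k < length xs
  k<len = m∸n≢0⇒n<m (λ eq → 1+n≢0 (trans len∸k≡suc eq))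

lengthℕ-encList : ∀ xs → lengthℕ (encList xs) ≡ length xs
lengthℕ-encList xs = trans (lengthUpTo-encList (encList xs) xs) (m≥n⇒m⊓n≡n (length≤encList xs))

sndℕ≤ : ∀ c → sndℕ c ≤ c
sndℕ≤ c = subst (sndℕ c ≤_) (pairℕ-unpair c) (n≤pairℕ (fstℕ c) (sndℕ c))

decodeWithin : ℕ → ℕ → List ℕ
decodeWithin zero       _       = []
decodeWithin (suc _)    zero    = []
decodeWithin (suc fuel) (suc c) = fstℕ c ∷ decodeWithin fuel (sndℕ c)

encList-decodeWithin : ∀ fuel c → c < fuel → encList (decodeWithin fuel c) ≡ c
encList-decodeWithin (suc fuel) zero    _        = refl
encList-decodeWithin (suc fuel) (suc c) (s≤s c<) =
  cong suc (trans (cong (pairℕ (fstℕ c)) (encList-decodeWithin fuel (sndℕ c) (≤-<-trans (sndℕ≤ c) c<)))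
                  (pairℕ-unpair c))

decode : ℕ → List ℕ
decode c = decodeWithin (suc c) c

encList-decode : ∀ c → encList (decode c) ≡ c
encList-decode c = encList-decodeWithin (suc c) c ≤-refl

lengthℕ≡length-decode : ∀ c → lengthℕ c ≡ length (decode c)
lengthℕ≡length-decode c = trans (cong lengthℕ (sym (encList-decode c))) (lengthℕ-encList (decode c))

lookupℕ≡nth-decode : ∀ i c → lookupℕ i c ≡ nth (decode c) i
lookupℕ≡nth-decode i c = trans (cong (lookupℕ i) (sym (encList-decode c))) (lookupℕ-encList i (decode c))

lengthℕ≤ : ∀ c → lengthℕ c ≤ c
lengthℕ≤ c = subst (_≤ c) (sym (lengthℕ≡length-decode c))
  (subst (length (decode c) ≤_) (encList-decode c) (length≤encList (decode c)))

prefix : Baire → ℕ → ℕ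
prefix x k = encList (applyUpTo x k)

applyUpTo-cong : ∀ {f g : ℕ → ℕ} n → (∀ i → i < n → f i ≡ g i) → applyUpTo f n ≡ applyUpTo g n
applyUpTo-cong zero    _   = refl
applyUpTo-cong (suc n) f≗g = cong₂ _∷_ (f≗g 0 z<s) (applyUpTo-cong n (λ i i< → f≗g (suc i) (s≤s i<)))

prefix-cong : ∀ {x y} k → (∀ i → i < k → x i ≡ y i) → prefix x k ≡ prefix y k
prefix-cong k x≗y = cong encList (applyUpTo-cong k x≗y)

lookupℕ-prefix : ∀ x k i → i < k → lookupℕ i (prefix x k) ≡ x i
lookupℕ-prefix x k i i<k = trans (lookupℕ-encList i (applyUpTo x k)) (nth-applyUpTo x k i i<k)
  where
  nth-applyUpTo : ∀ (x : Baire) k i → i < k → nth (applyUpTo x k) i ≡ x i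
  nth-applyUpTo x (suc k) zero    _        = refl
  nth-applyUpTo x (suc k) (suc i) (s≤s i<) = nth-applyUpTo (λ j → x (suc j)) k i i<

lengthℕ-prefix : ∀ x k → lengthℕ (prefix x k) ≡ k
lengthℕ-prefix x k = trans (lengthℕ-encList (applyUpTo x k)) (length-applyUpTo x k)

FirstNonZeroAt : (ℕ → ℕ) → ℕ → ℕ → Set
FirstNonZeroAt h k v = h k ≡ suc v × (∀ j → j < k → h j ≡ 0)

FirstNonZeroAt-functional : ∀ {h j k v w} → FirstNonZeroAt h j v → FirstNonZeroAt h k w → v ≡ w
FirstNonZeroAt-functional {j = j} {k} (hj , below-j) (hk , below-k) with <-cmp j k
... | tri< j<k _ _ = ⊥-elim (0≢1+n (trans (sym (below-k j j<k)) hj))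
... | tri> _ _ k<j = ⊥-elim (0≢1+n (trans (sym (below-j k k<j)) hk))
... | tri≈ _ refl _ = suc-injective (trans (sym hj) hk)

firstNonZero : (ℕ → ℕ) → ℕ → ℕ
firstNonZero h zero    = 0
firstNonZero h (suc t) = ifz (firstNonZero h t) (h t) (firstNonZero h t)

firstNonZero-none : ∀ h t → (∀ i → i < t → h i ≡ 0) → firstNonZero h t ≡ 0
firstNonZero-none h zero    _     = refl
firstNonZero-none h (suc t) zeros rewrite firstNonZero-none h t (λ i i< → zeros i (m≤n⇒m≤1+n i<)) = zeros t ≤-refl

firstNonZero-found : ∀ {h i v} t → FirstNonZeroAt h i v → i < t → firstNonZero h t ≡ suc v
firstNonZero-found {h} {i} (suc t) (hi , below) i<1+t with i ≟ t
... | yes refl rewrite firstNonZero-none h i below = hi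
... | no  i≢t  rewrite firstNonZero-found t (hi , below) (≤∧≢⇒< (≤-pred i<1+t) i≢t) = refl

firstNonZero≡0 : ∀ h t → firstNonZero h t ≡ 0 → ∀ i → i < t → h i ≡ 0
firstNonZero≡0 h (suc t) eq i i<1+t with firstNonZero h t in eq′
firstNonZero≡0 h (suc t) eq i i<1+t | zero with i ≟ t
... | yes refl = eq
... | no  i≢t  = firstNonZero≡0 h t eq′ i (≤∧≢⇒< (≤-pred i<1+t) i≢t)
firstNonZero≡0 h (suc t) () i i<1+t | suc _

firstNonZero≡suc : ∀ h t v → firstNonZero h t ≡ suc v → Σ ℕ λ i → i < t × FirstNonZeroAt h i v
firstNonZero≡suc h (suc t) v eq with firstNonZero h t in eq′
... | zero  = t , ≤-refl , eq , firstNonZero≡0 h t eq′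
... | suc w with firstNonZero≡suc h t w eq′
...   | i , i<t , hi , below = i , m≤n⇒m≤1+n i<t , trans hi eq , below

firstNonZero-cong : ∀ h h′ t → (∀ i → i < t → h i ≡ h′ i) → firstNonZero h t ≡ firstNonZero h′ t
firstNonZero-cong h h′ zero    _    = refl
firstNonZero-cong h h′ (suc t) h≗h′
  rewrite firstNonZero-cong h h′ t (λ i i< → h≗h′ i (m≤n⇒m≤1+n i<)) | h≗h′ t ≤-refl = refl

firstNonZero-≤ : ∀ h t M → (∀ i → i < t → h i ≤ M) → firstNonZero h t ≤ M
firstNonZero-≤ h zero    M _       = z≤n
firstNonZero-≤ h (suc t) M bounded with firstNonZero h t | firstNonZero-≤ h t M (λ i i< → bounded i (m≤n⇒m≤1+n i<))
... | zero  | _  = bounded t ≤-refl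
... | suc _ | ≤M = ≤M

leastNonZero : ∀ h K → 0 < h K → Σ ℕ λ k → 0 < h k × (∀ j → j < k → h j ≡ 0)
leastNonZero h K 0<hK with firstNonZero h (suc K) in eq
... | zero  = ⊥-elim (<⇒≢ 0<hK (sym (firstNonZero≡0 h (suc K) eq K ≤-refl)))
... | suc v with firstNonZero≡suc h (suc K) v eq
...   | i , _ , hi , below = i , subst (0 <_) (sym hi) z<s , below

projsᴿ : ∀ {n} m (f : Fin m → Fin n) → RecursiveVec n m (λ xs → tabulate (λ i → lookup xs (f i)))
projsᴿ zero    f = []ᴿ
projsᴿ (suc m) f = projᴿ (f zero) ∷ᴿ projsᴿ m (λ i → f (suc i))

firstNonZeroV : ∀ {n} → (Vec ℕ (suc n) → ℕ) → Vec ℕ (suc n) → ℕ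
firstNonZeroV g (t ∷ ps) = firstNonZero (λ i → g (i ∷ ps)) t

firstNonZeroVᴿ : ∀ {n g} → Recursive (suc n) g → Recursive (suc n) (firstNonZeroV g)
firstNonZeroVᴿ {n} {g} G =
  recursive-ext (precᴿ {g = step} zeroᴿ (call₃ ifzᴿ arg₁ (compᴿ G (arg₀ ∷ᴿ projsᴿ n (λ i → suc (suc i)))) arg₁)) unfold
  where
  step : Vec ℕ (2 + n) → ℕ
  step xs = ifz (lookup xs (suc zero)) (g (lookup xs zero ∷ tabulate (λ i → lookup xs (suc (suc i))))) (lookup xs (suc zero))
  unfold : ∀ xs → primRec (λ _ → 0) step xs ≡ firstNonZeroV g xs
  unfold (zero  ∷ ps) = refl
  unfold (suc t ∷ ps) rewrite unfold (t ∷ ps) | tabulate∘lookup ps = refl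

prefixV : ∀ {n} → (Vec ℕ (suc n) → ℕ) → Vec ℕ (suc n) → ℕ
prefixV g (j ∷ ps) = prefix (λ i → g (i ∷ ps)) j

-- the code of the entries j - t, …, j - 1, built from the end since consℕ prepends
lastEntries : ∀ {n} → (Vec ℕ (suc n) → ℕ) → ℕ → ℕ → Vec ℕ n → ℕ
lastEntries g zero    j ps = 0
lastEntries g (suc t) j ps = consℕ (g ((j ∸ suc t) ∷ ps)) (lastEntries g t j ps)

lastEntries-prefix : ∀ {n} (g : Vec ℕ (suc n) → ℕ) t j ps → t ≤ j →
                     lastEntries g t j ps ≡ prefix (λ i → g ((j ∸ t + i) ∷ ps)) t
lastEntries-prefix g zero    j ps _   = refl
lastEntries-prefix g (suc t) j ps t<j = cong₂ consℕ (cong (λ i → g (i ∷ ps)) (sym (+-identityʳ (j ∸ suc t))))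
  (trans (lastEntries-prefix g t j ps (<⇒≤ t<j)) (prefix-cong t (λ i _ → cong (λ k → g (k ∷ ps)) (shift i))))
  where
  shift : ∀ i → j ∸ t + i ≡ j ∸ suc t + suc i
  shift i = trans (cong (_+ i) (+-∸-assoc 1 t<j)) (sym (+-suc (j ∸ suc t) i))

prefixVᴿ : ∀ {n g} → Recursive (suc n) g → Recursive (suc n) (prefixV g)
prefixVᴿ {n} {g} G = recursive-ext
  (compᴿ (precᴿ {g = step} zeroᴿ
                (call₂ consᴿ (compᴿ G (call₂ ∸ᴿ arg₂ (sucᴿ arg₀) ∷ᴿ projsᴿ n (λ i → suc (suc (suc i))))) arg₁))
         (arg₀ ∷ᴿ arg₀ ∷ᴿ projsᴿ n suc))
  unfold
  where
  step : Vec ℕ (3 + n) → ℕ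
  step xs = consℕ (g ((lookup xs (suc (suc zero)) ∸ suc (lookup xs zero)) ∷ tabulate (λ i → lookup xs (suc (suc (suc i))))))
                  (lookup xs (suc zero))
  unfoldLast : ∀ t j ps → primRec (λ _ → 0) step (t ∷ j ∷ ps) ≡ lastEntries g t j ps
  unfoldLast zero    j ps = refl
  unfoldLast (suc t) j ps rewrite unfoldLast t j ps | tabulate∘lookup ps = refl
  unfold : ∀ xs → primRec (λ _ → 0) step (lookup xs zero ∷ lookup xs zero ∷ tabulate (λ i → lookup xs (suc i)))
                  ≡ prefixV g xs
  unfold (j ∷ ps) rewrite tabulate∘lookup ps =
    trans (unfoldLast j j ps) (trans (lastEntries-prefix g j j ps ≤-refl)
                                     (prefix-cong j (λ i _ → cong (λ k → g ((k + i) ∷ ps)) (n∸n≡0 j))))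

prefixᴿ : ∀ {x} → Recursive₁ x → Recursive₁ (prefix x)
prefixᴿ (mk₁ X) = mk₁ (recursive-ext (prefixVᴿ X) (λ { (k ∷ []) → refl }))

takeℕ : ℕ → ℕ → ℕ
takeℕ j c = prefix (entries c) j

takeᴿ : Recursive₂ takeℕ
takeᴿ = mk₂ (recursive-ext (prefixVᴿ {g = λ xs → lookupℕ (lookup xs zero) (lookup xs (suc zero))} (call₂ lookupᴿ arg₀ arg₁))
                           (λ { (j ∷ c ∷ []) → refl }))

takeℕ-prefix : ∀ (x : Baire) K j → j ≤ K → takeℕ j (prefix x K) ≡ prefix x j
takeℕ-prefix x K j j≤K = prefix-cong j (λ i i<j → lookupℕ-prefix x K i (<-≤-trans i<j j≤K))

takeℕ-≤ : ∀ j c → j ≤ lengthℕ c → takeℕ j c ≤ c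
takeℕ-≤ j c j≤len = subst (takeℕ j c ≤_) (encList-decode c)
  (subst (_≤ encList (decode c)) (prefix-cong j (λ i _ → sym (lookupℕ≡nth-decode i c)))
         (prefix-≤ (decode c) j (subst (j ≤_) (lengthℕ≡length-decode c) j≤len)))
  where
  prefix-≤ : ∀ zs j → j ≤ length zs → prefix (nth zs) j ≤ encList zs
  prefix-≤ zs       zero    _        = z≤n
  prefix-≤ (z ∷ zs) (suc j) (s≤s j≤) = s≤s (pairℕ-mono-≤ {z} ≤-refl (prefix-≤ zs j j≤))

codeBound : ℕ → ℕ → ℕ
codeBound zero    M = 0
codeBound (suc l) M = suc (pairℕ M (codeBound l M))

codeBoundᴿ : Recursive₂ codeBound
codeBoundᴿ = recursive₂-ext (primRec₁ᴿ (mk₁ zeroᴿ) (mk₃ (sucᴿ (call₂ pairᴿ arg₂ arg₁)))) primRec₁≡codeBound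
  where
  primRec₁≡codeBound : ∀ l M → primRec₁ (λ _ → 0) (λ _ r M → suc (pairℕ M r)) l M ≡ codeBound l M
  primRec₁≡codeBound zero    M = refl
  primRec₁≡codeBound (suc l) M = cong (λ r → suc (pairℕ M r)) (primRec₁≡codeBound l M)

prefix-≤-codeBound : ∀ (f : ℕ → ℕ) j l M → j ≤ l → (∀ i → i < j → f i ≤ M) → prefix f j ≤ codeBound l M
prefix-≤-codeBound f zero    l       M _        _       = z≤n
prefix-≤-codeBound f (suc j) (suc l) M (s≤s j≤) bounded =
  s≤s (pairℕ-mono-≤ (bounded 0 z<s) (prefix-≤-codeBound (λ i → f (suc i)) j l M j≤ (λ i i< → bounded (suc i) (s≤s i<))))

maxUpTo : (ℕ → ℕ) → ℕ → ℕ
maxUpTo f zero    = 0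
maxUpTo f (suc n) = maxUpTo f n ⊔ f n

≤-maxUpTo : ∀ f n i → i < n → f i ≤ maxUpTo f n
≤-maxUpTo f (suc n) i i<1+n with i ≟ n
... | yes refl = m≤n⊔m (maxUpTo f i) (f i)
... | no  i≢n  = ≤-trans (≤-maxUpTo f n i (≤∧≢⇒< (≤-pred i<1+n) i≢n)) (m≤m⊔n (maxUpTo f n) (f n))

maxEntry : ℕ → ℕ
maxEntry c = maxUpTo (entries c) c

maxEntryᴿ : Recursive₁ maxEntry
maxEntryᴿ = mk₁ (call₂ (recursive₂-ext (primRec₁ᴿ (mk₁ zeroᴿ) (mk₃ (call₂ ⊔ᴿ arg₁ (call₂ lookupᴿ arg₀ arg₂)))) unfold)
                        arg₀ arg₀)
  where
  unfold : ∀ t c → primRec₁ (λ _ → 0) (λ t r c → r ⊔ lookupℕ t c) t c ≡ maxUpTo (entries c) t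
  unfold zero    c = refl
  unfold (suc t) c = cong (_⊔ lookupℕ t c) (unfold t c)

lookupℕ-≤-maxEntry : ∀ i c → lookupℕ i c ≤ maxEntry c
lookupℕ-≤-maxEntry i c with i <? c
... | yes i<c = ≤-maxUpTo (entries c) c i i<c
... | no  i≮c = subst (_≤ maxEntry c) (sym outOfRange) z≤n
  where
  outOfRange : lookupℕ i c ≡ 0
  outOfRange = trans (lookupℕ≡nth-decode i c)
    (nth-beyond (decode c) i (≤-trans (subst (_≤ c) (lengthℕ≡length-decode c) (lengthℕ≤ c)) (≮⇒≥ i≮c)))
    where
    nth-beyond : ∀ zs i → length zs ≤ i → nth zs i ≡ 0
    nth-beyond []       i       _        = refl
    nth-beyond (z ∷ zs) (suc i) (s≤s le) = nth-beyond zs i le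

≈-refl : ∀ {x} → x ≈ x
≈-refl _ = refl

≈-sym : ∀ {x y} → x ≈ y → y ≈ x
≈-sym x≈y n = sym (x≈y n)

≈-trans : ∀ {x y z} → x ≈ y → y ≈ z → x ≈ z
≈-trans x≈y y≈z n = trans (x≈y n) (y≈z n)

App-functional : ∀ {c x y y′} → App c x y → App c x y′ → y ≈ y′
App-functional {c} {x} app app′ n = FirstNonZeroAt-functional {h = λ k → c (pairℕ n (prefix x k))}
  (proj₂ (app n)) (proj₂ (app′ n))

App-resp : ∀ {c c′ x x′ y y′} → c ≈ c′ → x ≈ x′ → y ≈ y′ → App c x y → App c′ x′ y′
App-resp {c} {c′} {x} {x′} c≈ x≈ y≈ app n with app n
... | k , hit , below = k ,
  trans (query-resp k) (trans hit (cong suc (y≈ n))) ,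
  λ j j<k → trans (query-resp j) (below j j<k)
  where
  query-resp : ∀ k → c′ (pairℕ n (prefix x′ k)) ≡ c (pairℕ n (prefix x k))
  query-resp k = trans (sym (c≈ _)) (cong (λ p → c (pairℕ n p)) (prefix-cong k (λ i _ → sym (x≈ i))))

Recursive₁⇒Computable : ∀ {c} → Recursive₁ c → Computable c
Recursive₁⇒Computable (mk₁ (recursive t ok)) = t , λ n → ok (n ∷ [])

Computable⇒Recursive₁ : ∀ {c} → Computable c → Recursive₁ c
Computable⇒Recursive₁ (t , ok) = mk₁ (recursive t (λ { (n ∷ []) → ok n }))

Computable-resp : ∀ {x y} → Computable x → x ≈ y → Computable y
Computable-resp (t , ok) x≈y = t , λ n → subst (Eval t (n ∷ [])) (x≈y n) (ok n)

-- The code that answers query n with H n p as soon as p codes a prefix of length L n of the input.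
afterReading : (ℕ → ℕ) → (ℕ → ℕ → ℕ) → Baire
afterReading L H m = ifz ∣ lengthℕ (sndℕ m) - L (fstℕ m) ∣ (suc (H (fstℕ m) (sndℕ m))) 0

afterReadingᴿ : ∀ L H → Recursive₁ L → Recursive₂ H → Recursive₁ (afterReading L H)
afterReadingᴿ L H Lᴿ Hᴿ = mk₁ (call₃ ifzᴿ (call₂ ∣-∣ᴿ (call₁ lengthᴿ (call₁ sndᴿ arg₀)) (call₁ Lᴿ (call₁ fstᴿ arg₀)))
                                   (sucᴿ (call₂ Hᴿ (call₁ fstᴿ arg₀) (call₁ sndᴿ arg₀))) (constᴿ 0))

App-afterReading : ∀ L H x y → (∀ n → H n (prefix x (L n)) ≡ y n) → App (afterReading L H) x y
App-afterReading L H x y answers n = L n , answered , waiting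
  where
  query : ∀ k → afterReading L H (pairℕ n (prefix x k)) ≡ ifz ∣ k - L n ∣ (suc (H n (prefix x k))) 0
  query k rewrite fstℕ-pairℕ n (prefix x k) | sndℕ-pairℕ n (prefix x k) | lengthℕ-prefix x k = refl
  answered : afterReading L H (pairℕ n (prefix x (L n))) ≡ suc (y n)
  answered rewrite query (L n) | ∣n-n∣≡0 (L n) = cong suc (answers n)
  waiting : ∀ j → j < L n → afterReading L H (pairℕ n (prefix x j)) ≡ 0
  waiting j j<L rewrite query j with ∣ j - L n ∣ in eq
  ... | zero  = ⊥-elim (<⇒≢ j<L (∣m-n∣≡0⇒m≡n eq))
  ... | suc _ = refl

identityᶜ : Baire
identityᶜ = afterReading suc lookupℕ

identityᶜ-recursive : Recursive₁ identityᶜ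
identityᶜ-recursive = afterReadingᴿ suc lookupℕ (mk₁ (sucᴿ arg₀)) lookupᴿ

App-identity : ∀ x → App identityᶜ x x
App-identity x = App-afterReading suc lookupℕ x x (λ n → lookupℕ-prefix x (suc n) n ≤-refl)

π₁ᶜ : Baire
π₁ᶜ = afterReading (λ n → 2 + (n + n)) (λ n → lookupℕ (suc (n + n)))

π₁ᶜ-recursive : Recursive₁ π₁ᶜ
π₁ᶜ-recursive = afterReadingᴿ (λ n → 2 + (n + n)) (λ n → lookupℕ (suc (n + n)))
  (mk₁ (sucᴿ (sucᴿ (call₂ +ᴿ arg₀ arg₀)))) (mk₂ (call₂ lookupᴿ (sucᴿ (call₂ +ᴿ arg₀ arg₀)) arg₁))

App-π₁ : ∀ w → App π₁ᶜ w (π₁ w)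
App-π₁ w = App-afterReading (λ n → 2 + (n + n)) (λ n → lookupℕ (suc (n + n))) w (π₁ w)
  (λ n → lookupℕ-prefix w _ (suc (n + n)) ≤-refl)

π₂ᶜ : Baire
π₂ᶜ = afterReading (λ n → 3 + (n + n)) (λ n → lookupℕ (2 + (n + n)))

π₂ᶜ-recursive : Recursive₁ π₂ᶜ
π₂ᶜ-recursive = afterReadingᴿ (λ n → 3 + (n + n)) (λ n → lookupℕ (2 + (n + n)))
  (mk₁ (sucᴿ (sucᴿ (sucᴿ (call₂ +ᴿ arg₀ arg₀))))) (mk₂ (call₂ lookupᴿ (sucᴿ (sucᴿ (call₂ +ᴿ arg₀ arg₀))) arg₁))

App-π₂ : ∀ w → App π₂ᶜ w (π₂ w)
App-π₂ w = App-afterReading (λ n → 3 + (n + n)) (λ n → lookupℕ (2 + (n + n))) w (π₂ w)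
  (λ n → lookupℕ-prefix w _ (2 + (n + n)) ≤-refl)

tailᴮ : Baire → Baire
tailᴮ w n = w (suc n)

tailᶜ : Baire
tailᶜ = afterReading (λ n → 2 + n) (λ n → lookupℕ (suc n))

tailᶜ-recursive : Recursive₁ tailᶜ
tailᶜ-recursive = afterReadingᴿ (λ n → 2 + n) (λ n → lookupℕ (suc n))
  (mk₁ (sucᴿ (sucᴿ arg₀))) (mk₂ (call₂ lookupᴿ (sucᴿ arg₀) arg₁))

App-tail : ∀ w → App tailᶜ w (tailᴮ w)
App-tail w = App-afterReading (λ n → 2 + n) (λ n → lookupℕ (suc n)) w (tailᴮ w) (λ n → lookupℕ-prefix w _ (suc n) ≤-refl)

in₂ᶜ : Baire
in₂ᶜ = afterReading (λ n → n) (λ n p → ifz n 1 (lookupℕ (pred n) p))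

in₂ᶜ-recursive : Recursive₁ in₂ᶜ
in₂ᶜ-recursive = afterReadingᴿ (λ n → n) (λ n p → ifz n 1 (lookupℕ (pred n) p))
  (mk₁ arg₀) (mk₂ (call₃ ifzᴿ arg₀ (constᴿ 1) (call₂ lookupᴿ (call₁ predᴿ arg₀) arg₁)))

App-in₂ : ∀ y → App in₂ᶜ y (in₂ y)
App-in₂ y = App-afterReading (λ n → n) (λ n p → ifz n 1 (lookupℕ (pred n) p)) y (in₂ y) answer
  where
  answer : ∀ n → ifz n 1 (lookupℕ (pred n) (prefix y n)) ≡ in₂ y n
  answer zero    = refl
  answer (suc n) = lookupℕ-prefix y (suc n) n ≤-refl

constᶜ : Baire → Baire
constᶜ x = afterReading (λ _ → 0) (λ n _ → x n)

App-const : ∀ x y → App (constᶜ x) y x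
App-const x y = App-afterReading (λ _ → 0) (λ n _ → x n) y x (λ _ → refl)

Kᶜ : Baire
Kᶜ = afterReading (λ m → suc (fstℕ m)) (λ m p → constᶜ (entries p) m)

Kᶜ-recursive : Recursive₁ Kᶜ
Kᶜ-recursive = afterReadingᴿ (λ m → suc (fstℕ m)) (λ m p → constᶜ (entries p) m) (mk₁ (sucᴿ (call₁ fstᴿ arg₀)))
  (mk₂ (call₃ ifzᴿ (call₂ ∣-∣ᴿ (call₁ lengthᴿ (call₁ sndᴿ arg₀)) (constᴿ 0))
                   (sucᴿ (call₂ lookupᴿ (call₁ fstᴿ arg₀) arg₁)) (constᴿ 0)))

App-K : ∀ x → App Kᶜ x (constᶜ x)
App-K x = App-afterReading (λ m → suc (fstℕ m)) (λ m p → constᶜ (entries p) m) x (constᶜ x)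
  (λ m → cong (λ v → ifz ∣ lengthℕ (sndℕ m) - 0 ∣ (suc v) 0) (lookupℕ-prefix x (suc (fstℕ m)) (fstℕ m) ≤-refl))

K̄ᶜ : Baire
K̄ᶜ = afterReading (λ _ → 0) (λ m _ → identityᶜ m)

K̄ᶜ-recursive : Recursive₁ K̄ᶜ
K̄ᶜ-recursive = afterReadingᴿ (λ _ → 0) (λ m _ → identityᶜ m) (mk₁ (constᴿ 0)) (mk₂ (call₁ identityᶜ-recursive arg₀))

App-K̄ : ∀ x → App K̄ᶜ x identityᶜ
App-K̄ x = App-afterReading (λ _ → 0) (λ m _ → identityᶜ m) x identityᶜ (λ _ → refl)

-- selectᶜ · z · f · g is f when z 0 = 0 and g otherwise
selectOn : Baire → Baire
selectOn z m = ifz (z 0) (Kᶜ m) (K̄ᶜ m)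

selectᶜ : Baire
selectᶜ = afterReading (λ _ → 1) (λ m p → ifz (lookupℕ 0 p) (Kᶜ m) (K̄ᶜ m))

selectᶜ-recursive : Recursive₁ selectᶜ
selectᶜ-recursive = afterReadingᴿ (λ _ → 1) (λ m p → ifz (lookupℕ 0 p) (Kᶜ m) (K̄ᶜ m))
  (mk₁ (constᴿ 1)) (mk₂ (call₃ ifzᴿ (call₂ lookupᴿ (constᴿ 0) arg₁) (call₁ Kᶜ-recursive arg₀) (call₁ K̄ᶜ-recursive arg₀)))

App-select : ∀ z → App selectᶜ z (selectOn z)
App-select z = App-afterReading (λ _ → 1) (λ m p → ifz (lookupℕ 0 p) (Kᶜ m) (K̄ᶜ m)) z (selectOn z)
  (λ m → cong (λ v → ifz v (Kᶜ m) (K̄ᶜ m)) (lookupℕ-prefix z 1 0 z<s))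

App-selectOn-zero : ∀ {z} f → z 0 ≡ 0 → App (selectOn z) f (constᶜ f)
App-selectOn-zero {z} f z0≡0 =
  App-resp (λ m → cong (λ v → ifz v (Kᶜ m) (K̄ᶜ m)) (sym z0≡0)) ≈-refl ≈-refl (App-K f)

App-selectOn-suc : ∀ {z k} f → z 0 ≡ suc k → App (selectOn z) f identityᶜ
App-selectOn-suc {z} f z0≡suc =
  App-resp (λ m → cong (λ v → ifz v (Kᶜ m) (K̄ᶜ m)) (sym z0≡suc)) ≈-refl ≈-refl (App-K̄ f)

isOdd : ℕ → ℕ
isOdd zero    = 0
isOdd (suc m) = 1 ∸ isOdd m

half : ℕ → ℕ
half zero    = 0
half (suc m) = half m + isOdd m

isOdd≤1 : ∀ m → isOdd m ≤ 1
isOdd≤1 zero    = z≤n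
isOdd≤1 (suc m) = m∸n≤m 1 (isOdd m)

isOdd-ss : ∀ m → isOdd (2 + m) ≡ isOdd m
isOdd-ss m with isOdd m | isOdd≤1 m
... | zero        | _       = refl
... | suc zero    | _       = refl
... | suc (suc _) | s≤s ()

half-ss : ∀ m → half (2 + m) ≡ suc (half m)
half-ss m with isOdd m | isOdd≤1 m
... | zero        | _       = trans (cong (_+ 1) (+-identityʳ (half m))) (+-comm (half m) 1)
... | suc zero    | _       = trans (+-identityʳ (half m + 1)) (+-comm (half m) 1)
... | suc (suc _) | s≤s ()

half<suc : ∀ m → half m < suc m
half<suc zero          = z<s
half<suc (suc zero)    = z<s
half<suc (suc (suc m)) rewrite half-ss m = s≤s (m≤n⇒m≤1+n (half<suc m))

isOdd-double : ∀ n → isOdd (n + n) ≡ 0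
isOdd-double zero    = refl
isOdd-double (suc n) rewrite +-suc n n = trans (isOdd-ss (n + n)) (isOdd-double n)

half-double : ∀ n → half (n + n) ≡ n
half-double zero    = refl
half-double (suc n) rewrite +-suc n n = trans (half-ss (n + n)) (cong suc (half-double n))

isOddᴿ : Recursive₁ isOdd
isOddᴿ = recursive₁-ext (primRec₀ᴿ {a = 0} {b = λ _ r → 1 ∸ r} (mk₂ (call₂ ∸ᴿ (constᴿ 1) arg₁))) unfold
  where
  unfold : ∀ m → primRec₀ 0 (λ _ r → 1 ∸ r) m ≡ isOdd m
  unfold zero    = refl
  unfold (suc m) = cong (1 ∸_) (unfold m)

-- the recursion step of half needs isOdd, so the two are computed as one pair
halfAndOdd : ℕ → ℕ
halfAndOdd m = pairℕ (half m) (isOdd m)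

halfAndOddᴿ : Recursive₁ halfAndOdd
halfAndOddᴿ = recursive₁-ext
  (primRec₀ᴿ {b = λ _ r → pairℕ (fstℕ r + sndℕ r) (1 ∸ sndℕ r)}
             (mk₂ (call₂ pairᴿ (call₂ +ᴿ (call₁ fstᴿ arg₁) (call₁ sndᴿ arg₁))
                               (call₂ ∸ᴿ (constᴿ 1) (call₁ sndᴿ arg₁)))))
  unfold
  where
  unfold : ∀ m → primRec₀ 0 (λ _ r → pairℕ (fstℕ r + sndℕ r) (1 ∸ sndℕ r)) m ≡ halfAndOdd m
  unfold zero    = refl
  unfold (suc m) rewrite unfold m | fstℕ-pairℕ (half m) (isOdd m) | sndℕ-pairℕ (half m) (isOdd m) = refl

halfᴿ : Recursive₁ half
halfᴿ = recursive₁-ext (mk₁ (call₁ fstᴿ (call₁ halfAndOddᴿ arg₀))) (λ m → fstℕ-pairℕ (half m) (isOdd m))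

tupleAt : Baire → Baire → ℕ → ℕ
tupleAt x y zero    = 1
tupleAt x y (suc n) = ifz (isOdd n) (x (half n)) (y (half n))

⟨,⟩≡tupleAt : ∀ x y n → ⟨ x , y ⟩ n ≡ tupleAt x y n
⟨,⟩≡tupleAt x y zero                = refl
⟨,⟩≡tupleAt x y (suc zero)          = refl
⟨,⟩≡tupleAt x y (suc (suc zero))    = refl
⟨,⟩≡tupleAt x y (suc (suc (suc n))) rewrite ⟨,⟩≡tupleAt (λ k → x (suc k)) (λ k → y (suc k)) (suc n)
                                           | isOdd-ss n | half-ss n = refl

tupleAt-congˡ : ∀ {x x′} y n → (∀ i → i < n → x i ≡ x′ i) → tupleAt x y n ≡ tupleAt x′ y n
tupleAt-congˡ y zero    _   = refl
tupleAt-congˡ y (suc n) x≗x′ = cong (λ v → ifz (isOdd n) v (y (half n))) (x≗x′ (half n) (half<suc n))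

tupleAt-congʳ : ∀ x {y y′} n → (∀ i → i < n → y i ≡ y′ i) → tupleAt x y n ≡ tupleAt x y′ n
tupleAt-congʳ x zero    _   = refl
tupleAt-congʳ x (suc n) y≗y′ = cong (ifz (isOdd n) (x (half n))) (y≗y′ (half n) (half<suc n))

π₁-⟨,⟩ : ∀ x y → π₁ ⟨ x , y ⟩ ≈ x
π₁-⟨,⟩ x y n rewrite ⟨,⟩≡tupleAt x y (suc (n + n)) | isOdd-double n | half-double n = refl

π₂-⟨,⟩ : ∀ x y → π₂ ⟨ x , y ⟩ ≈ y
π₂-⟨,⟩ x y n rewrite ⟨,⟩≡tupleAt x y (2 + (n + n)) | isOdd-double n | +-identityʳ (half (n + n)) | half-double n = refl

π₁-cong : ∀ {x y} → x ≈ y → π₁ x ≈ π₁ y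
π₁-cong x≈y n = x≈y _

π₂-cong : ∀ {x y} → x ≈ y → π₂ x ≈ π₂ y
π₂-cong x≈y n = x≈y _

pairWithᶜ : Baire → Baire
pairWithᶜ x = afterReading (λ n → n) (λ n p → tupleAt x (entries p) n)

App-pairWith : ∀ x y → App (pairWithᶜ x) y ⟨ x , y ⟩
App-pairWith x y = App-afterReading (λ n → n) (λ n p → tupleAt x (entries p) n) y ⟨ x , y ⟩
  (λ n → trans (tupleAt-congʳ x n (λ i i<n → lookupℕ-prefix y n i i<n)) (sym (⟨,⟩≡tupleAt x y n)))

pairᶜ : Baire
pairᶜ = afterReading fstℕ (λ m p → pairWithᶜ (entries p) m)

pairᶜ-recursive : Recursive₁ pairᶜ
pairᶜ-recursive = afterReadingᴿ fstℕ (λ m p → pairWithᶜ (entries p) m) (mk₁ (call₁ fstᴿ arg₀))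
  (mk₂ (call₃ ifzᴿ (call₂ ∣-∣ᴿ (call₁ lengthᴿ (call₁ sndᴿ arg₀)) (call₁ fstᴿ arg₀))
                   (sucᴿ (call₃ tupleAtᴿ arg₁ (call₁ sndᴿ arg₀) (call₁ fstᴿ arg₀))) (constᴿ 0)))
  where
  tupleAtᴿ : Recursive₃ (λ cx cy n → tupleAt (entries cx) (entries cy) n)
  tupleAtᴿ = mk₃ (recursive-ext
    (call₃ ifzᴿ arg₂ (constᴿ 1) (call₃ ifzᴿ (call₁ isOddᴿ (call₁ predᴿ arg₂))
                                        (call₂ lookupᴿ (call₁ halfᴿ (call₁ predᴿ arg₂)) arg₀)
                                        (call₂ lookupᴿ (call₁ halfᴿ (call₁ predᴿ arg₂)) arg₁)))
    λ { (cx ∷ cy ∷ zero ∷ []) → refl ; (cx ∷ cy ∷ suc n ∷ []) → refl })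

App-pair : ∀ x → App pairᶜ x (pairWithᶜ x)
App-pair x = App-afterReading fstℕ (λ m p → pairWithᶜ (entries p) m) x (pairWithᶜ x)
  (λ m → cong (λ v → ifz ∣ lengthℕ (sndℕ m) - fstℕ m ∣ (suc v) 0)
              (tupleAt-congˡ (entries (sndℕ m)) (fstℕ m) (λ i i< → lookupℕ-prefix x (fstℕ m) i i<)))

-- Application on finite prefixes. A partial answer 0 means "not determined by the prefix",
-- and suc v means v.

partialApp : Baire → ℕ → ℕ → ℕ
partialApp c p i = firstNonZero (λ j → c (pairℕ i (takeℕ j p))) (suc (lengthℕ p))

partialApp-prefix : ∀ c z K i → partialApp c (prefix z K) i ≡ firstNonZero (λ j → c (pairℕ i (prefix z j))) (suc K)
partialApp-prefix c z K i rewrite lengthℕ-prefix z K =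
  firstNonZero-cong _ _ (suc K) (λ j j<1+K → cong (λ q → c (pairℕ i q)) (takeℕ-prefix z K j (≤-pred j<1+K)))

module _ (c z y : Baire) (app : App c z y) where

  partialApp-complete : ∀ K i → proj₁ (app i) ≤ K → partialApp c (prefix z K) i ≡ suc (y i)
  partialApp-complete K i used≤K =
    trans (partialApp-prefix c z K i) (firstNonZero-found (suc K) (proj₂ (app i)) (s≤s used≤K))

  partialApp-sound : ∀ K i v → partialApp c (prefix z K) i ≡ suc v → v ≡ y i
  partialApp-sound K i v eq with firstNonZero≡suc _ (suc K) v (trans (sym (partialApp-prefix c z K i)) eq)
  ... | _ , _ , at = FirstNonZeroAt-functional at (proj₂ (app i))

  partialApp-cases : ∀ K i → partialApp c (prefix z K) i ≡ 0 ⊎ partialApp c (prefix z K) i ≡ suc (y i)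
  partialApp-cases K i with partialApp c (prefix z K) i in eq
  ... | zero  = inj₁ refl
  ... | suc v = inj₂ (cong suc (partialApp-sound K i v eq))

-- Composition on finite prefixes: the partial value of (x · z) · (y · z) at n.

anyUndetermined : Baire → ℕ → ℕ → ℕ
anyUndetermined y p j = firstNonZero (λ i → ifz (partialApp y p i) 1 0) j

partialPrefix : Baire → ℕ → ℕ → ℕ
partialPrefix y p j = prefix (λ i → pred (partialApp y p i)) j

outerQuery : Baire → Baire → ℕ → ℕ → ℕ → ℕ
outerQuery x y p n j = partialApp x p (pairℕ n (partialPrefix y p j))

-- 0 continues the search over j, 1 stops it undetermined and suc (suc v) stops it with value v
composeStep : Baire → Baire → ℕ → ℕ → ℕ → ℕ
composeStep x y p n j =
  ifz (anyUndetermined y p j) (ifz (outerQuery x y p n j) 1 (ifz (pred (outerQuery x y p n j)) 0 (outerQuery x y p n j))) 1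

partialCompose : Baire → Baire → ℕ → ℕ → ℕ
partialCompose x y p n = pred (firstNonZero (composeStep x y p n) (suc (lengthℕ p)))

S₂ᶜ : Baire → Baire → Baire
S₂ᶜ x y m = partialCompose x y (sndℕ m) (fstℕ m)

Determined : Baire → ℕ → Baire → ℕ → Set
Determined y p Y j = ∀ i → i < j → partialApp y p i ≡ suc (Y i)

anyUndetermined-none : ∀ {y p Y} j → Determined y p Y j → anyUndetermined y p j ≡ 0
anyUndetermined-none j det = firstNonZero-none _ j (λ i i<j → cong (λ v → ifz v 1 0) (det i i<j))

partialPrefix-determined : ∀ {y p Y} j → Determined y p Y j → partialPrefix y p j ≡ prefix Y j
partialPrefix-determined j det = prefix-cong j (λ i i<j → cong pred (det i i<j))

module _ (x y z X Y R : Baire) (appX : App x z X) (appY : App y z Y) (appR : App X Y R) where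

  private
    outer : ℕ → ℕ → ℕ
    outer n j = X (pairℕ n (prefix Y j))

  anyUndetermined≡0 : ∀ K j → anyUndetermined y (prefix z K) j ≡ 0 → Determined y (prefix z K) Y j
  anyUndetermined≡0 K j eq i i<j with partialApp-cases y z Y appY K i | firstNonZero≡0 _ j eq i i<j
  ... | inj₁ undetermined | stop rewrite undetermined = ⊥-elim (1+n≢0 stop)
  ... | inj₂ determined   | _    = determined

  outerQuery-sound : ∀ K n j v → anyUndetermined y (prefix z K) j ≡ 0 →
                     outerQuery x y (prefix z K) n j ≡ suc v → v ≡ outer n j
  outerQuery-sound K n j v none eq = partialApp-sound x z X appX K _ v
    (trans (cong (λ q → partialApp x (prefix z K) (pairℕ n q))
                 (sym (partialPrefix-determined {y} {prefix z K} {Y} j (anyUndetermined≡0 K j none))))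
           eq)

  composeStep≡0 : ∀ K n j → composeStep x y (prefix z K) n j ≡ 0 → outer n j ≡ 0
  composeStep≡0 K n j eq with anyUndetermined y (prefix z K) j in none
  ... | suc _ = ⊥-elim (1+n≢0 eq)
  ... | zero with outerQuery x y (prefix z K) n j in q
  ...   | zero        = ⊥-elim (1+n≢0 eq)
  ...   | suc zero    = sym (outerQuery-sound K n j 0 none q)
  ...   | suc (suc _) = ⊥-elim (1+n≢0 eq)

  composeStep≡suc-suc : ∀ K n j v → composeStep x y (prefix z K) n j ≡ suc (suc v) → outer n j ≡ suc v
  composeStep≡suc-suc K n j v eq with anyUndetermined y (prefix z K) j in none
  ... | suc _ = ⊥-elim (1+n≢0 (suc-injective (sym eq)))
  ... | zero with outerQuery x y (prefix z K) n j in q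
  ...   | zero        = ⊥-elim (1+n≢0 (suc-injective (sym eq)))
  ...   | suc zero    = ⊥-elim (0≢1+n eq)
  ...   | suc (suc w) = sym (trans (cong suc (suc-injective (suc-injective (sym eq)))) (outerQuery-sound K n j (suc w) none q))

  partialCompose-sound : ∀ K n v → partialCompose x y (prefix z K) n ≡ suc v → v ≡ R n
  partialCompose-sound K n v eq with firstNonZero (composeStep x y (prefix z K) n) (suc (lengthℕ (prefix z K))) in found
  partialCompose-sound K n v () | zero
  partialCompose-sound K n v () | suc zero
  partialCompose-sound K n v refl | suc (suc _) with firstNonZero≡suc (composeStep x y (prefix z K) n) (suc (lengthℕ (prefix z K))) (suc v) found
  ... | j , _ , step-j , below = FirstNonZeroAt-functional {h = outer n}
          (composeStep≡suc-suc K n j v step-j , λ i i<j → composeStep≡0 K n i (below i i<j)) (proj₂ (appR n))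

  composeStep-determined : ∀ K n j → Determined y (prefix z K) Y j → proj₁ (appX (pairℕ n (prefix Y j))) ≤ K →
                           composeStep x y (prefix z K) n j ≡ ifz (outer n j) 0 (suc (outer n j))
  composeStep-determined K n j det used≤K
    rewrite anyUndetermined-none {y} {prefix z K} {Y} j det | partialPrefix-determined {y} {prefix z K} {Y} j det
          | partialApp-complete x z X appX K _ used≤K = refl

  partialCompose-complete : ∀ n → Σ ℕ λ K → partialCompose x y (prefix z K) n ≡ suc (R n)
  partialCompose-complete n = K , found
    where
    -- K reads enough of z to determine Y below k and the queries of X at ⟨ n , Y restricted to j ⟩ for j ≤ k
    k : ℕ
    k = proj₁ (appR n)
    useY useX : ℕ → ℕ
    useY i = proj₁ (appY i)
    useX j = proj₁ (appX (pairℕ n (prefix Y j)))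
    K : ℕ
    K = (k ⊔ maxUpTo useY k) ⊔ maxUpTo useX (suc k)
    k≤K : k ≤ K
    k≤K = ≤-trans (m≤m⊔n k (maxUpTo useY k)) (m≤m⊔n (k ⊔ maxUpTo useY k) (maxUpTo useX (suc k)))
    determined : ∀ j → j ≤ k → Determined y (prefix z K) Y j
    determined j j≤k i i<j = partialApp-complete y z Y appY K i
      (≤-trans (≤-maxUpTo useY k i (<-≤-trans i<j j≤k))
               (≤-trans (m≤n⊔m k (maxUpTo useY k)) (m≤m⊔n (k ⊔ maxUpTo useY k) (maxUpTo useX (suc k)))))
    step : ∀ j → j ≤ k → composeStep x y (prefix z K) n j ≡ ifz (outer n j) 0 (suc (outer n j))
    step j j≤k = composeStep-determined K n j (determined j j≤k)
      (≤-trans (≤-maxUpTo useX (suc k) j (s≤s j≤k)) (m≤n⊔m (k ⊔ maxUpTo useY k) (maxUpTo useX (suc k))))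
    step-k : composeStep x y (prefix z K) n k ≡ suc (suc (R n))
    step-k rewrite step k ≤-refl | proj₁ (proj₂ (appR n)) = refl
    step-below : ∀ j → j < k → composeStep x y (prefix z K) n j ≡ 0
    step-below j j<k rewrite step j (<⇒≤ j<k) | proj₂ (proj₂ (appR n)) j j<k = refl
    found : partialCompose x y (prefix z K) n ≡ suc (R n)
    found = begin
      partialCompose x y (prefix z K) n
        ≡⟨ cong (λ t → pred (firstNonZero (composeStep x y (prefix z K) n) (suc t))) (lengthℕ-prefix z K) ⟩
      pred (firstNonZero (composeStep x y (prefix z K) n) (suc K))
        ≡⟨ cong pred (firstNonZero-found {composeStep x y (prefix z K) n} {k} {suc (R n)} (suc K) (step-k , step-below) (s≤s k≤K)) ⟩
      suc (R n) ∎
      where open ≡-Reasoning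

  App-S₂ : App (S₂ᶜ x y) z R
  App-S₂ n = k , hit , λ j j<k → trans (query j) (below j j<k)
    where
    value : ℕ → ℕ
    value K = partialCompose x y (prefix z K) n
    least : Σ ℕ λ k → 0 < value k × (∀ j → j < k → value j ≡ 0)
    least = leastNonZero value (proj₁ (partialCompose-complete n))
                         (subst (0 <_) (sym (proj₂ (partialCompose-complete n))) z<s)
    k : ℕ
    k = proj₁ least
    below : ∀ j → j < k → value j ≡ 0
    below = proj₂ (proj₂ least)
    query : ∀ K → S₂ᶜ x y (pairℕ n (prefix z K)) ≡ value K
    query K = cong₂ (partialCompose x y) (sndℕ-pairℕ n (prefix z K)) (fstℕ-pairℕ n (prefix z K))
    found : suc (pred (value k)) ≡ value k
    found = suc-pred (value k) {{>-nonZero (proj₁ (proj₂ least))}}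
    hit : S₂ᶜ x y (pairℕ n (prefix z k)) ≡ suc (R n)
    hit = trans (query k) (trans (sym found) (cong suc (partialCompose-sound k n (pred (value k)) (sym found))))

AgreeBelow : Baire → Baire → ℕ → Set
AgreeBelow c c′ B = ∀ q → q < B → c q ≡ c′ q

partialApp-agree : ∀ c c′ p i → AgreeBelow c c′ (suc (pairℕ (lengthℕ p) p)) → i ≤ lengthℕ p →
                   partialApp c p i ≡ partialApp c′ p i
partialApp-agree c c′ p i agree i≤len = firstNonZero-cong _ _ (suc (lengthℕ p))
  (λ j j≤len → agree _ (s≤s (pairℕ-mono-≤ i≤len (takeℕ-≤ j p (≤-pred j≤len)))))

partialCompose-congʳ : ∀ x y y′ p n → AgreeBelow y y′ (suc (pairℕ (lengthℕ p) p)) →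
                       partialCompose x y p n ≡ partialCompose x y′ p n
partialCompose-congʳ x y y′ p n agree = cong pred (firstNonZero-cong _ _ (suc (lengthℕ p)) (λ j j≤len → step j (≤-pred j≤len)))
  where
  same : ∀ j → j ≤ lengthℕ p → ∀ i → i < j → partialApp y p i ≡ partialApp y′ p i
  same j j≤len i i<j = partialApp-agree y y′ p i agree (≤-trans (<⇒≤ i<j) j≤len)
  step : ∀ j → j ≤ lengthℕ p → composeStep x y p n j ≡ composeStep x y′ p n j
  step j j≤len
    rewrite firstNonZero-cong (λ i → ifz (partialApp y p i) 1 0) (λ i → ifz (partialApp y′ p i) 1 0) j
                              (λ i i<j → cong (λ v → ifz v 1 0) (same j j≤len i i<j))
          | prefix-cong {λ i → pred (partialApp y p i)} {λ i → pred (partialApp y′ p i)} j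
                        (λ i i<j → cong pred (same j j≤len i i<j)) = refl

partialPrefix-≤ : ∀ y p j M → (∀ q → y q ≤ M) → j ≤ lengthℕ p → partialPrefix y p j ≤ codeBound (lengthℕ p) M
partialPrefix-≤ y p j M y≤M j≤len = prefix-≤-codeBound _ j (lengthℕ p) M j≤len
  (λ i _ → ≤-trans pred[n]≤n (firstNonZero-≤ _ (suc (lengthℕ p)) M (λ _ _ → y≤M _)))

partialCompose-congˡ : ∀ x x′ y p n M → (∀ q → y q ≤ M) →
                       AgreeBelow x x′ (suc (pairℕ (pairℕ n (codeBound (lengthℕ p) M)) p)) →
                       partialCompose x y p n ≡ partialCompose x′ y p n
partialCompose-congˡ x x′ y p n M y≤M agree = cong pred (firstNonZero-cong _ _ (suc (lengthℕ p)) (λ j j≤len → step j (≤-pred j≤len)))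
  where
  outer : ∀ j → j ≤ lengthℕ p → outerQuery x y p n j ≡ outerQuery x′ y p n j
  outer j j≤len = firstNonZero-cong _ _ (suc (lengthℕ p)) (λ j′ j′≤len → agree _ (s≤s
    (pairℕ-mono-≤ (pairℕ-mono-≤ {n} ≤-refl (partialPrefix-≤ y p j M y≤M j≤len)) (takeℕ-≤ j′ p (≤-pred j′≤len)))))
  step : ∀ j → j ≤ lengthℕ p → composeStep x y p n j ≡ composeStep x′ y p n j
  step j j≤len rewrite outer j j≤len = refl

-- The combinator S, with S · x · y · z = (x · z) · (y · z)

yDemand : ℕ → ℕ
yDemand m = suc (pairℕ (lengthℕ (sndℕ m)) (sndℕ m))

S₁ᶜ : Baire → Baire
S₁ᶜ x = afterReading yDemand (λ m p → S₂ᶜ x (entries p) m)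

xDemand : ℕ → ℕ
xDemand m = suc (pairℕ (pairℕ (fstℕ (fstℕ m)) (codeBound (lengthℕ (sndℕ (fstℕ m))) (maxEntry (sndℕ m)))) (sndℕ (fstℕ m)))

Sᶜ : Baire
Sᶜ = afterReading xDemand (λ m p → S₁ᶜ (entries p) m)

App-S₁ : ∀ x y → App (S₁ᶜ x) y (S₂ᶜ x y)
App-S₁ x y = App-afterReading yDemand (λ m p → S₂ᶜ x (entries p) m) y (S₂ᶜ x y)
  (λ m → partialCompose-congʳ x _ y (sndℕ m) (fstℕ m) (λ q q< → lookupℕ-prefix y (yDemand m) q q<))

App-S : ∀ x → App Sᶜ x (S₁ᶜ x)
App-S x = App-afterReading xDemand (λ m p → S₁ᶜ (entries p) m) x (S₁ᶜ x)
  (λ m → cong (λ v → ifz ∣ lengthℕ (sndℕ m) - yDemand (fstℕ m) ∣ (suc v) 0)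
    (partialCompose-congˡ _ x (entries (sndℕ m)) (sndℕ (fstℕ m)) (fstℕ (fstℕ m)) (maxEntry (sndℕ m))
       (λ q → lookupℕ-≤-maxEntry q (sndℕ m)) (λ q q< → lookupℕ-prefix x (xDemand m) q q<)))

partialAppᴿ : Recursive₃ (λ cx p i → partialApp (entries cx) p i)
partialAppᴿ = mk₃ (recursive-ext
  (compᴿ (firstNonZeroVᴿ {g = λ xs → lookupℕ (pairℕ (lookup xs (suc (suc (suc zero))))
                                                     (takeℕ (lookup xs zero) (lookup xs (suc (suc zero)))))
                                              (lookup xs (suc zero))}
                         (call₂ lookupᴿ (call₂ pairᴿ arg₃ (call₂ takeᴿ arg₀ arg₂)) arg₁))
         (sucᴿ (call₁ lengthᴿ arg₁) ∷ᴿ arg₀ ∷ᴿ arg₁ ∷ᴿ arg₂ ∷ᴿ []ᴿ))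
  (λ { (cx ∷ p ∷ i ∷ []) → refl }))

anyUndeterminedᴿ : Recursive₃ (λ cy p j → anyUndetermined (entries cy) p j)
anyUndeterminedᴿ = mk₃ (recursive-ext
  (compᴿ (firstNonZeroVᴿ {g = λ xs → ifz (partialApp (entries (lookup xs (suc zero))) (lookup xs (suc (suc zero))) (lookup xs zero)) 1 0}
                         (call₃ ifzᴿ (call₃ partialAppᴿ arg₁ arg₂ arg₀) (constᴿ 1) (constᴿ 0)))
         (arg₂ ∷ᴿ arg₀ ∷ᴿ arg₁ ∷ᴿ []ᴿ))
  (λ { (cy ∷ p ∷ j ∷ []) → refl }))

partialPrefixᴿ : Recursive₃ (λ cy p j → partialPrefix (entries cy) p j)
partialPrefixᴿ = mk₃ (recursive-ext
  (compᴿ (prefixVᴿ {g = λ xs → pred (partialApp (entries (lookup xs (suc zero))) (lookup xs (suc (suc zero))) (lookup xs zero))}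
                   (call₁ predᴿ (call₃ partialAppᴿ arg₁ arg₂ arg₀)))
         (arg₂ ∷ᴿ arg₀ ∷ᴿ arg₁ ∷ᴿ []ᴿ))
  (λ { (cy ∷ p ∷ j ∷ []) → refl }))

partialComposeᴿ : Recursive₄ (λ cx cy p n → partialCompose (entries cx) (entries cy) p n)
partialComposeᴿ = mk₄ (recursive-ext
  (call₁ predᴿ (compᴿ (firstNonZeroVᴿ composeStepᴿ)
                      (sucᴿ (call₁ lengthᴿ arg₂) ∷ᴿ arg₀ ∷ᴿ arg₁ ∷ᴿ arg₂ ∷ᴿ arg₃ ∷ᴿ []ᴿ)))
  (λ { (cx ∷ cy ∷ p ∷ n ∷ []) → refl }))
  where
  outerQueryᴿ : Recursive 5 (λ xs → outerQuery (entries (lookup xs (suc zero))) (entries (lookup xs (suc (suc zero))))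
                                                (lookup xs (suc (suc (suc zero)))) (lookup xs (suc (suc (suc (suc zero))))) (lookup xs zero))
  outerQueryᴿ = call₃ partialAppᴿ arg₁ arg₃ (call₂ pairᴿ arg₄ (call₃ partialPrefixᴿ arg₂ arg₃ arg₀))
  composeStepᴿ : Recursive 5 (λ xs → composeStep (entries (lookup xs (suc zero))) (entries (lookup xs (suc (suc zero))))
                                                  (lookup xs (suc (suc (suc zero)))) (lookup xs (suc (suc (suc (suc zero))))) (lookup xs zero))
  composeStepᴿ = call₃ ifzᴿ (call₃ anyUndeterminedᴿ arg₂ arg₃ arg₀)
                           (call₃ ifzᴿ outerQueryᴿ (constᴿ 1) (call₃ ifzᴿ (call₁ predᴿ outerQueryᴿ) (constᴿ 0) outerQueryᴿ))
                           (constᴿ 1)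

Sᶜ-recursive : Recursive₁ Sᶜ
Sᶜ-recursive = afterReadingᴿ xDemand (λ m p → S₁ᶜ (entries p) m)
  (mk₁ (sucᴿ (call₂ pairᴿ (call₂ pairᴿ (call₁ fstᴿ (call₁ fstᴿ arg₀))
                                      (call₂ codeBoundᴿ (call₁ lengthᴿ (call₁ sndᴿ (call₁ fstᴿ arg₀)))
                                                        (call₁ maxEntryᴿ (call₁ sndᴿ arg₀))))
                          (call₁ sndᴿ (call₁ fstᴿ arg₀)))))
  (mk₂ (call₃ ifzᴿ (call₂ ∣-∣ᴿ (call₁ lengthᴿ (call₁ sndᴿ arg₀))
                               (sucᴿ (call₂ pairᴿ (call₁ lengthᴿ (call₁ sndᴿ (call₁ fstᴿ arg₀))) (call₁ sndᴿ (call₁ fstᴿ arg₀)))))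
                   (sucᴿ (call₄ partialComposeᴿ arg₁ (call₁ sndᴿ arg₀) (call₁ sndᴿ (call₁ fstᴿ arg₀))
                                                (call₁ fstᴿ (call₁ fstᴿ arg₀))))
                   (constᴿ 0)))

Computable-App : ∀ {c x y} → Computable c → Computable x → App c x y → Computable y
Computable-App {c} {x} {y} c-computable x-computable app =
  Recursive₁⇒Computable (recursive₁-ext (mk₁ (call₁ predᴿ (call₁ cᴿ (call₂ pairᴿ arg₀ (call₁ (prefixᴿ xᴿ) useᴿ)))))
                                        (λ n → cong pred (proj₁ (proj₂ (app n)))))
  where
  cᴿ : Recursive₁ c
  cᴿ = Computable⇒Recursive₁ c-computable
  xᴿ : Recursive₁ x
  xᴿ = Computable⇒Recursive₁ x-computable
  useᴿ : Recursive 1 (λ xs → proj₁ (app (lookup xs zero)))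
  useᴿ = μᴿ {f = λ xs → ifz (c (pairℕ (lookup xs (suc zero)) (prefix x (lookup xs zero)))) 1 0}
    (call₃ ifzᴿ (call₁ cᴿ (call₂ pairᴿ arg₁ (call₁ (prefixᴿ xᴿ) arg₀))) (constᴿ 1) (constᴿ 0))
    (λ xs → proj₁ (app (lookup xs zero)))
    (λ { (n ∷ []) → cong (λ v → ifz v 1 0) (proj₁ (proj₂ (app n))) })
    (λ { (n ∷ []) j j<use → subst (λ v → 0 < ifz v 1 0) (sym (proj₂ (proj₂ (app n)) j j<use)) z<s })

•-computable : Computable •
•-computable = Recursive₁⇒Computable (mk₁ zeroᴿ)

infixl 7 _∙_
data Term (n : ℕ) : Set where
  var : Fin n → Term n
  con : Baire → Term n
  _∙_ : Term n → Term n → Term n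

-- a record, so that Agda can infer f, a and y from a proof
record Applies (f a y : Baire) : Set where
  constructor applies
  field app : App f a y

data Ev {n} (ρ : Vec Baire n) : Term n → Baire → Set where
  ev-var : ∀ {i y} → lookup ρ i ≈ y → Ev ρ (var i) y
  ev-con : ∀ {c y} → c ≈ y → Ev ρ (con c) y
  ev-app : ∀ {t u f a y} → Ev ρ t f → Ev ρ u a → Applies f a y → Ev ρ (t ∙ u) y

ev-const : ∀ {n} {ρ : Vec Baire n} {c} → Ev ρ (con c) c
ev-const {c = c} = ev-con (≈-refl {c})

ev-lookup : ∀ {n} {ρ : Vec Baire n} {i} → Ev ρ (var i) (lookup ρ i)
ev-lookup {ρ = ρ} {i} = ev-var (≈-refl {lookup ρ i})

data ComputableConstants {n} : Term n → Set where
  cc-var : ∀ {i} → ComputableConstants (var i)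
  cc-con : ∀ {c} → Computable c → ComputableConstants (con c)
  cc-app : ∀ {t u} → ComputableConstants t → ComputableConstants u → ComputableConstants (t ∙ u)

Ev-closed-computable : ∀ {t : Term 0} {y} → ComputableConstants t → Ev [] t y → Computable y
Ev-closed-computable (cc-con c-computable) (ev-con c≈y)        = Computable-resp c-computable c≈y
Ev-closed-computable (cc-app cc-t cc-u)    (ev-app et eu (applies app)) =
  Computable-App (Ev-closed-computable cc-t et) (Ev-closed-computable cc-u eu) app

Sᶜ-computable : Computable Sᶜ
Sᶜ-computable = Recursive₁⇒Computable Sᶜ-recursive

Kᶜ-computable : Computable Kᶜ
Kᶜ-computable = Recursive₁⇒Computable Kᶜ-recursive

App-SKK : ∀ a → App (S₂ᶜ Kᶜ Kᶜ) a a
App-SKK a = App-S₂ Kᶜ Kᶜ a (constᶜ a) (constᶜ a) a (App-K a) (App-K a) (App-const a (constᶜ a))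

-- Bracket abstraction, opaque so that the large combinator terms are never unfolded.

opaque
  ƛ : ∀ {n} → Term (suc n) → Term n
  ƛ (var zero)    = con Sᶜ ∙ con Kᶜ ∙ con Kᶜ
  ƛ (var (suc i)) = con Kᶜ ∙ var i
  ƛ (con c)       = con Kᶜ ∙ con c
  ƛ (t ∙ u)       = con Sᶜ ∙ ƛ t ∙ ƛ u

  ƛ-sound : ∀ {n} (t : Term (suc n)) (ρ : Vec Baire n) →
            Σ Baire λ F → Ev ρ (ƛ t) F × (∀ a y → Ev (a ∷ ρ) t y → App F a y)
  ƛ-sound (var zero) ρ = S₂ᶜ Kᶜ Kᶜ ,
    ev-app (ev-app ev-const ev-const (applies (App-S Kᶜ))) ev-const (applies (App-S₁ Kᶜ Kᶜ)) ,
    λ { a y (ev-var a≈y) → App-resp {S₂ᶜ Kᶜ Kᶜ} {S₂ᶜ Kᶜ Kᶜ} {a} {a} {a} ≈-refl ≈-refl a≈y (App-SKK a) }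
  ƛ-sound (var (suc i)) ρ = constᶜ (lookup ρ i) , ev-app ev-const ev-lookup (applies (App-K (lookup ρ i))) ,
    λ { a y (ev-var ρi≈y) →
          App-resp {constᶜ (lookup ρ i)} {constᶜ (lookup ρ i)} {a} {a} ≈-refl ≈-refl ρi≈y (App-const (lookup ρ i) a) }
  ƛ-sound (con c) ρ = constᶜ c , ev-app ev-const ev-const (applies (App-K c)) ,
    λ { a y (ev-con c≈y) → App-resp {constᶜ c} {constᶜ c} {a} {a} ≈-refl ≈-refl c≈y (App-const c a) }
  ƛ-sound (t ∙ u) ρ with ƛ-sound t ρ | ƛ-sound u ρ
  ... | Ft , et , ht | Fu , eu , hu = S₂ᶜ Ft Fu ,
    ev-app (ev-app ev-const et (applies (App-S Ft))) eu (applies (App-S₁ Ft Fu)) ,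
    λ { a y (ev-app {f = f} {a = b} et′ eu′ (applies app)) → App-S₂ Ft Fu a f b y (ht a f et′) (hu a b eu′) app }

  ƛ-computable : ∀ {n} (t : Term (suc n)) → ComputableConstants t → ComputableConstants (ƛ t)
  ƛ-computable (var zero)    _              = cc-app (cc-app (cc-con Sᶜ-computable) (cc-con Kᶜ-computable)) (cc-con Kᶜ-computable)
  ƛ-computable (var (suc i)) _              = cc-app (cc-con Kᶜ-computable) cc-var
  ƛ-computable (con c)       (cc-con cc)    = cc-app (cc-con Kᶜ-computable) (cc-con cc)
  ƛ-computable (t ∙ u)       (cc-app ct cu) = cc-app (cc-app (cc-con Sᶜ-computable) (ƛ-computable t ct)) (ƛ-computable u cu)

rename : ∀ {n m} → (Fin n → Fin m) → Term n → Term m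
rename f (var i) = var (f i)
rename f (con c) = con c
rename f (t ∙ u) = rename f t ∙ rename f u

Ev-rename : ∀ {n m} (f : Fin n → Fin m) {ρ : Vec Baire n} {ρ′ : Vec Baire m} →
            (∀ i → lookup ρ′ (f i) ≈ lookup ρ i) → ∀ {t y} → Ev ρ t y → Ev ρ′ (rename f t) y
Ev-rename f ρ′∘f≈ρ (ev-var ρi≈y)   = ev-var (≈-trans (ρ′∘f≈ρ _) ρi≈y)
Ev-rename f ρ′∘f≈ρ (ev-con c≈y)    = ev-con c≈y
Ev-rename f ρ′∘f≈ρ (ev-app et eu app) = ev-app (Ev-rename f ρ′∘f≈ρ et) (Ev-rename f ρ′∘f≈ρ eu) app

rename-computable : ∀ {n m} (f : Fin n → Fin m) (t : Term n) → ComputableConstants t → ComputableConstants (rename f t)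
rename-computable f (var i) _              = cc-var
rename-computable f (con c) (cc-con cc)    = cc-con cc
rename-computable f (t ∙ u) (cc-app ct cu) = cc-app (rename-computable f t ct) (rename-computable f u cu)

weaken : ∀ {n} → Term 0 → Term n
weaken = rename (λ ())

Ev-weaken : ∀ {n} {ρ : Vec Baire n} {t y} → Ev [] t y → Ev ρ (weaken t) y
Ev-weaken = Ev-rename (λ ()) (λ ())

weaken-computable : ∀ {n} (t : Term 0) → ComputableConstants t → ComputableConstants {n} (weaken t)
weaken-computable = rename-computable (λ ())

ev-ƛ : ∀ {n} {ρ : Vec Baire n} t → Σ Baire λ F → Ev ρ (ƛ t) F
ev-ƛ {ρ = ρ} t = proj₁ (ƛ-sound t ρ) , proj₁ (proj₂ (ƛ-sound t ρ))

-- Fixed points by self-application: fix body · w behaves as body with D · D = fix body.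

fix : ∀ {n} → Term (2 + n) → Term n
fix body = ƛ (ƛ body) ∙ ƛ (ƛ body)

fix-sound : ∀ {n} (body : Term (2 + n)) (ρ : Vec Baire n) →
  Σ Baire λ D → Σ Baire λ A → Ev ρ (fix body) A × App D D A × (∀ w y → Ev (w ∷ D ∷ ρ) body y → App A w y)
fix-sound body ρ with ƛ-sound (ƛ body) ρ
... | D , eD , hD with ƛ-sound body (D ∷ ρ)
...   | A , eA , hA = D , A , ev-app eD eD (applies (hD D A eA)) , hD D A eA , hA

fix-computable : ∀ {n} (body : Term (2 + n)) → ComputableConstants body → ComputableConstants (fix body)
fix-computable body cc = cc-app (ƛ-computable _ (ƛ-computable body cc)) (ƛ-computable _ (ƛ-computable body cc))

pattern v₀ = var zero
pattern v₁ = var (suc zero)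
pattern v₂ = var (suc (suc zero))
pattern v₃ = var (suc (suc (suc zero)))
pattern v₄ = var (suc (suc (suc (suc zero))))
pattern v₅ = var (suc (suc (suc (suc (suc zero)))))

π₁ᵗ π₂ᵗ tailᵗ in₂ᵗ : ∀ {n} → Term n → Term n
π₁ᵗ t = con π₁ᶜ ∙ t
π₂ᵗ t = con π₂ᶜ ∙ t
tailᵗ t = con tailᶜ ∙ t
in₂ᵗ t = con in₂ᶜ ∙ t

⟨_,_⟩ᵗ : ∀ {n} → Term n → Term n → Term n
⟨ t , u ⟩ᵗ = con pairᶜ ∙ t ∙ u

-- evaluates the branch t₁ (if z 0 = 0) or t₂ (otherwise) with the value of tw bound to v₀
ifZero : ∀ {n} → Term n → Term (suc n) → Term (suc n) → Term n → Term n
ifZero tz t₁ t₂ tw = con selectᶜ ∙ tz ∙ ƛ t₁ ∙ ƛ t₂ ∙ tw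

module _ {n} {ρ : Vec Baire n} where

  ev-π₁ : ∀ {t w} → Ev ρ t w → Ev ρ (π₁ᵗ t) (π₁ w)
  ev-π₁ {w = w} et = ev-app ev-const et (applies (App-π₁ w))

  ev-π₂ : ∀ {t w} → Ev ρ t w → Ev ρ (π₂ᵗ t) (π₂ w)
  ev-π₂ {w = w} et = ev-app ev-const et (applies (App-π₂ w))

  ev-tail : ∀ {t w} → Ev ρ t w → Ev ρ (tailᵗ t) (tailᴮ w)
  ev-tail {w = w} et = ev-app ev-const et (applies (App-tail w))

  ev-in₂ : ∀ {t w} → Ev ρ t w → Ev ρ (in₂ᵗ t) (in₂ w)
  ev-in₂ {w = w} et = ev-app ev-const et (applies (App-in₂ w))

  ev-⟨,⟩ : ∀ {t u x y} → Ev ρ t x → Ev ρ u y → Ev ρ ⟨ t , u ⟩ᵗ ⟨ x , y ⟩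
  ev-⟨,⟩ {x = x} {y} et eu = ev-app (ev-app ev-const et (applies (App-pair x))) eu (applies (App-pairWith x y))

  ev-ifZero-zero : ∀ {tz t₁ t₂ tw z a y} → Ev ρ tz z → z 0 ≡ 0 → Ev ρ tw a → Ev (a ∷ ρ) t₁ y →
                   Ev ρ (ifZero tz t₁ t₂ tw) y
  ev-ifZero-zero {tz} {t₁} {t₂} {tw} {z} {a} {y} ez z0≡0 ew e₁ with ƛ-sound t₁ ρ | ev-ƛ {ρ = ρ} t₂
  ... | F₁ , eF₁ , F₁-spec | F₂ , eF₂ =
    ev-app (ev-app (ev-app (ev-app ev-const ez (applies (App-select z))) eF₁ (applies (App-selectOn-zero {z} F₁ z0≡0)))
                   eF₂ (applies (App-const F₁ F₂)))
           ew (applies (F₁-spec a y e₁))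

  ev-ifZero-suc : ∀ {tz t₁ t₂ tw z a y k} → Ev ρ tz z → z 0 ≡ suc k → Ev ρ tw a → Ev (a ∷ ρ) t₂ y →
                  Ev ρ (ifZero tz t₁ t₂ tw) y
  ev-ifZero-suc {tz} {t₁} {t₂} {tw} {z} {a} {y} ez z0≡suc ew e₂ with ev-ƛ {ρ = ρ} t₁ | ƛ-sound t₂ ρ
  ... | F₁ , eF₁ | F₂ , eF₂ , F₂-spec =
    ev-app (ev-app (ev-app (ev-app ev-const ez (applies (App-select z))) eF₁ (applies (App-selectOn-suc {z} F₁ z0≡suc)))
                   eF₂ (applies (App-identity F₂)))
           ew (applies (F₂-spec a y e₂))

ƛ²-value : ∀ (body : Term 2) {a₁ a₂ y} → Ev (a₂ ∷ a₁ ∷ []) body y →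
           ∀ {n} {ρ : Vec Baire n} {t₁ t₂} → Ev ρ t₁ a₁ → Ev ρ t₂ a₂ → Ev ρ (weaken (ƛ (ƛ body)) ∙ t₁ ∙ t₂) y
ƛ²-value body {a₁} {a₂} {y} eb e₁ e₂ with ƛ-sound (ƛ body) [] | ƛ-sound body (a₁ ∷ [])
... | F₁ , eF₁ , F₁-spec | F₂ , eF₂ , F₂-spec =
  ev-app (ev-app (Ev-weaken eF₁) e₁ (applies (F₁-spec a₁ F₂ eF₂))) e₂ (applies (F₂-spec a₂ y eb))

ƛ³-partial : ∀ (body : Term 3) a₁ a₂ → Σ Baire λ F →
  (∀ {n} {ρ : Vec Baire n} {t₁ t₂} → Ev ρ t₁ a₁ → Ev ρ t₂ a₂ → Ev ρ (weaken (ƛ (ƛ (ƛ body))) ∙ t₁ ∙ t₂) F) ×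
  (∀ a₃ y → Ev (a₃ ∷ a₂ ∷ a₁ ∷ []) body y → App F a₃ y)
ƛ³-partial body a₁ a₂ with ƛ-sound (ƛ (ƛ body)) [] | ƛ-sound (ƛ body) (a₁ ∷ []) | ƛ-sound body (a₂ ∷ a₁ ∷ [])
... | F₁ , eF₁ , F₁-spec | F₂ , eF₂ , F₂-spec | F₃ , eF₃ , F₃-spec =
  F₃ , (λ e₁ e₂ → ev-app (ev-app (Ev-weaken eF₁) e₁ (applies (F₁-spec a₁ F₂ eF₂))) e₂ (applies (F₂-spec a₂ F₃ eF₃))) ,
  F₃-spec

-- For an instance w = ⟨ r , ⟨ ⟨ u , d ⟩ , c ⟩ ⟩ of R ⊓ (P ⋆ Q◇) and a solution x of Q(u), the residual
-- instance for the subtree d · x is ⟨ r , ⟨ d · x , continuation w x ⟩ ⟩, where continuation w x codes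
-- z ↦ c · ⟨ x , z ⟩. Given a code h of the forward reduction, reducedInstance h w = ⟨ r , ⟨ u , e ⟩ ⟩
-- is an instance of R ⊓ (P ⋆ Q), where e = subproblems h w codes x ↦ h · (residual instance for x).

continuationBody : Term 3
continuationBody = π₂ᵗ (π₂ᵗ v₂) ∙ ⟨ v₁ , v₀ ⟩ᵗ

continuationᵗ : Term 0
continuationᵗ = ƛ (ƛ (ƛ continuationBody))

opaque
  continuation : Baire → Baire → Baire
  continuation w x = proj₁ (ƛ³-partial continuationBody w x)

  ev-continuation : ∀ {n} {ρ : Vec Baire n} {t₁ t₂ w x} → Ev ρ t₁ w → Ev ρ t₂ x →
                    Ev ρ (weaken continuationᵗ ∙ t₁ ∙ t₂) (continuation w x)
  ev-continuation {w = w} {x} = proj₁ (proj₂ (ƛ³-partial continuationBody w x))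

  App-continuation : ∀ w x z v → App (π₂ (π₂ w)) ⟨ x , z ⟩ v → App (continuation w x) z v
  App-continuation w x z v app = proj₂ (proj₂ (ƛ³-partial continuationBody w x)) z v
    (ev-app (ev-π₂ (ev-π₂ ev-lookup)) (ev-⟨,⟩ ev-lookup ev-lookup) (applies app))

residual : Baire → Baire → Baire → Baire
residual w x dx = ⟨ π₁ w , ⟨ dx , continuation w x ⟩ ⟩

residualᵗ : Term 0
residualᵗ = ƛ (ƛ ⟨ π₁ᵗ v₁ , ⟨ π₂ᵗ (π₁ᵗ (π₂ᵗ v₁)) ∙ v₀ , weaken continuationᵗ ∙ v₁ ∙ v₀ ⟩ᵗ ⟩ᵗ)

ev-residual : ∀ {n} {ρ : Vec Baire n} {t₁ t₂ w x dx} → App (π₂ (π₁ (π₂ w))) x dx → Ev ρ t₁ w → Ev ρ t₂ x →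
              Ev ρ (weaken residualᵗ ∙ t₁ ∙ t₂) (residual w x dx)
ev-residual app = ƛ²-value _
  (ev-⟨,⟩ (ev-π₁ ev-lookup) (ev-⟨,⟩ (ev-app (ev-π₂ (ev-π₁ (ev-π₂ ev-lookup))) ev-lookup (applies app))
                                   (ev-continuation ev-lookup ev-lookup)))

subproblemsBody : Term 3
subproblemsBody = v₂ ∙ (weaken residualᵗ ∙ v₁ ∙ v₀)

subproblemsᵗ : Term 0
subproblemsᵗ = ƛ (ƛ (ƛ subproblemsBody))

opaque
  subproblems : Baire → Baire → Baire
  subproblems h w = proj₁ (ƛ³-partial subproblemsBody h w)

  ev-subproblems : ∀ {n} {ρ : Vec Baire n} {t₁ t₂ h w} → Ev ρ t₁ h → Ev ρ t₂ w →
                   Ev ρ (weaken subproblemsᵗ ∙ t₁ ∙ t₂) (subproblems h w)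
  ev-subproblems {h = h} {w} = proj₁ (proj₂ (ƛ³-partial subproblemsBody h w))

  App-subproblems : ∀ h w x dx v → App (π₂ (π₁ (π₂ w))) x dx → App h (residual w x dx) v → App (subproblems h w) x v
  App-subproblems h w x dx v app-d app-h = proj₂ (proj₂ (ƛ³-partial subproblemsBody h w)) x v
    (ev-app ev-lookup (ev-residual app-d ev-lookup ev-lookup) (applies app-h))

reducedInstance : Baire → Baire → Baire
reducedInstance h w = ⟨ π₁ w , ⟨ π₁ (π₁ (π₂ w)) , subproblems h w ⟩ ⟩

reducedInstanceᵗ : Term 0
reducedInstanceᵗ = ƛ (ƛ ⟨ π₁ᵗ v₀ , ⟨ π₁ᵗ (π₁ᵗ (π₂ᵗ v₀)) , weaken subproblemsᵗ ∙ v₁ ∙ v₀ ⟩ᵗ ⟩ᵗ)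

ev-reducedInstance : ∀ {n} {ρ : Vec Baire n} {t₁ t₂ h w} → Ev ρ t₁ h → Ev ρ t₂ w →
                     Ev ρ (weaken reducedInstanceᵗ ∙ t₁ ∙ t₂) (reducedInstance h w)
ev-reducedInstance = ƛ²-value _
  (ev-⟨,⟩ (ev-π₁ ev-lookup) (ev-⟨,⟩ (ev-π₁ (ev-π₁ (ev-π₂ ev-lookup))) (ev-subproblems ev-lookup ev-lookup)))

-- The recursion equations of a forward code A and backward codes backward w
-- for R ⊓ (P ⋆ Q◇) ≤W P, built from a reduction (a , b) of R ⊓ (P ⋆ Q) to P.
record Iteration (a b A b′ : Baire) : Set where
  field
    backward    : Baire → Baire
    b′-backward : ∀ u y r → App (backward u) y r → App b′ ⟨ u , y ⟩ r
    A-root      : ∀ w v → π₁ (π₂ w) 0 ≡ 0 → App (π₂ (π₂ w)) • v → App A w v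
    A-step      : ∀ w v {k} → π₁ (π₂ w) 0 ≡ suc k → App a (reducedInstance A w) v → App A w v
    backward-root    : ∀ w y → π₁ (π₂ w) 0 ≡ 0 → App (backward w) y (in₂ ⟨ • , y ⟩)
    backward-in₁     : ∀ w y o {k} → π₁ (π₂ w) 0 ≡ suc k → App b ⟨ reducedInstance A w , y ⟩ o → o 0 ≡ 0 →
                       App (backward w) y o
    backward-in₂-in₁ : ∀ w y o dx o′ {k k′} → π₁ (π₂ w) 0 ≡ suc k → App b ⟨ reducedInstance A w , y ⟩ o → o 0 ≡ suc k′ →
                       App (π₂ (π₁ (π₂ w))) (π₁ (tailᴮ o)) dx →
                       App (backward (residual w (π₁ (tailᴮ o)) dx)) (π₂ (tailᴮ o)) o′ → o′ 0 ≡ 0 →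
                       App (backward w) y o′
    backward-in₂-in₂ : ∀ w y o dx o′ {k k′ k″} → π₁ (π₂ w) 0 ≡ suc k → App b ⟨ reducedInstance A w , y ⟩ o → o 0 ≡ suc k′ →
                       App (π₂ (π₁ (π₂ w))) (π₁ (tailᴮ o)) dx →
                       App (backward (residual w (π₁ (tailᴮ o)) dx)) (π₂ (tailᴮ o)) o′ → o′ 0 ≡ suc k″ →
                       App (backward w) y (in₂ ⟨ ⟨ π₁ (tailᴮ o) , π₁ (tailᴮ o′) ⟩ , π₂ (tailᴮ o′) ⟩)

SolD-resp : ∀ {Q w w′ z z′} → IsExt Q → w ≈ w′ → z ≈ z′ → SolD Q w z → SolD Q w′ z′
SolD-resp extQ w≈ z≈ (s• w≈• z≈•) = s• (≈-trans (≈-sym w≈) w≈•) (≈-trans (≈-sym z≈) z≈•)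
SolD-resp {w = w} {w′} extQ w≈ z≈ (sstep {x = x} {v = v} w0≡1 sx app S z≈⟨⟩) =
  sstep (trans (sym (w≈ 0)) w0≡1) (proj₂ extQ (π₁-cong w≈) ≈-refl sx)
        (App-resp {π₂ w} {π₂ w′} {x} {x} {v} (π₂-cong w≈) ≈-refl ≈-refl app) S (≈-trans (≈-sym z≈) z≈⟨⟩)

in₂-components : ∀ {o q x y} → o ≈ in₂ q → q ≈ ⟨ x , y ⟩ → x ≈ π₁ (tailᴮ o) × y ≈ π₂ (tailᴮ o)
in₂-components {o} {q} {x} {y} o≈ q≈ =
  ≈-sym (≈-trans (π₁-cong tail≈) (π₁-⟨,⟩ x y)) , ≈-sym (≈-trans (π₂-cong tail≈) (π₂-⟨,⟩ x y))
  where
  tail≈ : tailᴮ o ≈ ⟨ x , y ⟩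
  tail≈ n = trans (o≈ (suc n)) (q≈ n)

π₁π₂-residual : ∀ w x dx → π₁ (π₂ (residual w x dx)) ≈ dx
π₁π₂-residual w x dx = ≈-trans (π₁-cong (π₂-⟨,⟩ (π₁ w) ⟨ dx , continuation w x ⟩)) (π₁-⟨,⟩ dx (continuation w x))

π₂π₂-residual : ∀ w x dx → π₂ (π₂ (residual w x dx)) ≈ continuation w x
π₂π₂-residual w x dx = ≈-trans (π₂-cong (π₂-⟨,⟩ (π₁ w) ⟨ dx , continuation w x ⟩)) (π₂-⟨,⟩ dx (continuation w x))

π₁π₂-reducedInstance : ∀ h w → π₁ (π₂ (reducedInstance h w)) ≈ π₁ (π₁ (π₂ w))
π₁π₂-reducedInstance h w =
  ≈-trans (π₁-cong (π₂-⟨,⟩ (π₁ w) ⟨ π₁ (π₁ (π₂ w)) , subproblems h w ⟩))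
          (π₁-⟨,⟩ (π₁ (π₁ (π₂ w))) (subproblems h w))

π₂π₂-reducedInstance : ∀ h w → π₂ (π₂ (reducedInstance h w)) ≈ subproblems h w
π₂π₂-reducedInstance h w =
  ≈-trans (π₂-cong (π₂-⟨,⟩ (π₁ w) ⟨ π₁ (π₁ (π₂ w)) , subproblems h w ⟩))
          (π₂-⟨,⟩ (π₁ (π₁ (π₂ w))) (subproblems h w))

module Correctness (P Q R : Problem) (extP : IsExt P) (extQ : IsExt Q) (extR : IsExt R)
                   {a b A b′ : Baire} (it : Iteration a b A b′) (red : Witnesses (R ⊓ (P ⋆ Q)) P a b) where
  open Iteration it

  -- The tree z is kept apart from w: the induction runs over DomD Q z, while the tree component
  -- of a residual instance agrees with the subtree only pointwise.
  InstanceAt : Baire → Baire → Set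
  InstanceAt z w = (π₁ (π₂ w) ≈ z) × dom R (π₁ w) × (∀ x → SolD Q z x → π₂ (π₂ w) · x ∈ dom P)

  Handled : Baire → Set
  Handled w = (A · w ∈ dom P) × (∀ v → App A w v → ∀ y → sol P v y → backward w · y ∈ sol (R ⊓ (P ⋆ (Q ◇))) w)

  handled-root : ∀ {z} w → z ≈ • → InstanceAt z w → Handled w
  handled-root {z} w z≈• (w≈z , _ , cont) with cont • (s• z≈• ≈-refl)
  ... | v , app-c , dom-v = (v , A-root w v root app-c , dom-v) , backward-ok
    where
    root : π₁ (π₂ w) 0 ≡ 0
    root = trans (w≈z 0) (z≈• 0)
    backward-ok : ∀ v′ → App A w v′ → ∀ y → sol P v′ y → backward w · y ∈ sol (R ⊓ (P ⋆ (Q ◇))) w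
    backward-ok v′ app-A y sy = in₂ ⟨ • , y ⟩ , backward-root w y root ,
      inj₂ (⟨ • , y ⟩ , ≈-refl , • , y , ≈-refl , s• (≈-trans w≈z z≈•) ≈-refl , v , app-c ,
            proj₂ extP (App-functional {A} {w} app-A (A-root w v root app-c)) ≈-refl sy)

  module Step {z} (w : Baire) (z0≡1 : z 0 ≡ 1) (dom-u : dom Q (π₁ z))
              (sub : ∀ x → sol Q (π₁ z) x → Σ Baire λ dx → App (π₂ z) x dx × (∀ w′ → InstanceAt dx w′ → Handled w′))
              (inst : InstanceAt z w) where

    w≈z : π₁ (π₂ w) ≈ z
    w≈z = proj₁ inst

    step : π₁ (π₂ w) 0 ≡ 1
    step = trans (w≈z 0) z0≡1

    App-d : ∀ {x dx} → App (π₂ z) x dx → App (π₂ (π₁ (π₂ w))) x dx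
    App-d {x} {dx} = App-resp {π₂ z} {π₂ (π₁ (π₂ w))} {x} {x} {dx} (π₂-cong (≈-sym w≈z)) ≈-refl ≈-refl

    residual-instance : ∀ x dx → sol Q (π₁ z) x → App (π₂ z) x dx → InstanceAt dx (residual w x dx)
    residual-instance x dx sx app-d =
      π₁π₂-residual w x dx , proj₁ extR (≈-sym (π₁-⟨,⟩ (π₁ w) _)) (proj₁ (proj₂ inst)) , cont
      where
      cont : ∀ z′ → SolD Q dx z′ → π₂ (π₂ (residual w x dx)) · z′ ∈ dom P
      cont z′ S with proj₂ (proj₂ inst) ⟨ x , z′ ⟩ (sstep z0≡1 sx app-d S ≈-refl)
      ... | v , app-c , dom-v = v ,
        App-resp {continuation w x} {π₂ (π₂ (residual w x dx))} {z′} {z′} {v} (≈-sym (π₂π₂-residual w x dx)) ≈-refl ≈-refl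
                 (App-continuation w x z′ v app-c) , dom-v

    W : Baire
    W = reducedInstance A w

    W≈z : π₁ (π₂ W) ≈ π₁ z
    W≈z = ≈-trans (π₁π₂-reducedInstance A w) (π₁-cong w≈z)

    W-sol : ∀ {x} → sol Q (π₁ (π₂ W)) x → sol Q (π₁ z) x
    W-sol = proj₂ extQ W≈z ≈-refl

    subproblem-dom : ∀ x → sol Q (π₁ (π₂ W)) x → π₂ (π₂ W) · x ∈ dom P
    subproblem-dom x sx = forward (sub x (W-sol sx))
      where
      forward : (Σ Baire λ dx → App (π₂ z) x dx × (∀ w′ → InstanceAt dx w′ → Handled w′)) → π₂ (π₂ W) · x ∈ dom P
      forward (dx , app-d , handled) = lift (proj₁ (handled (residual w x dx) (residual-instance x dx (W-sol sx) app-d)))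
        where
        lift : A · residual w x dx ∈ dom P → π₂ (π₂ W) · x ∈ dom P
        lift (v , app-A , dom-v) = v ,
          App-resp {subproblems A w} {π₂ (π₂ W)} {x} {x} {v} (≈-sym (π₂π₂-reducedInstance A w)) ≈-refl ≈-refl
                   (App-subproblems A w x dx v (App-d app-d) app-A) , dom-v

    W-dom : dom (R ⊓ (P ⋆ Q)) W
    W-dom = refl , proj₁ extR (≈-sym (π₁-⟨,⟩ (π₁ w) _)) (proj₁ (proj₂ inst)) ,
            refl , proj₁ extQ (≈-sym W≈z) dom-u , subproblem-dom

    from-residual : ∀ y o dx → App b ⟨ W , y ⟩ o → o 0 ≡ 1 → sol Q (π₁ z) (π₁ (tailᴮ o)) →
                    App (π₂ z) (π₁ (tailᴮ o)) dx →
                    backward (residual w (π₁ (tailᴮ o)) dx) · π₂ (tailᴮ o)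
                      ∈ sol (R ⊓ (P ⋆ (Q ◇))) (residual w (π₁ (tailᴮ o)) dx) →
                    backward w · y ∈ sol (R ⊓ (P ⋆ (Q ◇))) w
    from-residual y o dx app-b o0≡1 sx app-d (o′ , app-o′ , inj₁ (r , o′≈ , sr)) =
      o′ , backward-in₂-in₁ w y o dx o′ step app-b o0≡1 (App-d app-d) app-o′ (o′≈ 0) ,
      inj₁ (r , o′≈ , proj₂ extR (π₁-⟨,⟩ (π₁ w) _) ≈-refl sr)
    from-residual y o dx app-b o0≡1 sx app-d (o′ , app-o′ , inj₂ (q , o′≈ , z′ , y′ , q≈ , S , v , app-c , sy′)) =
      in₂ ⟨ ⟨ x , z″ ⟩ , y″ ⟩ , backward-in₂-in₂ w y o dx o′ step app-b o0≡1 (App-d app-d) app-o′ (o′≈ 0) ,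
      inj₂ (⟨ ⟨ x , z″ ⟩ , y″ ⟩ , ≈-refl , ⟨ x , z″ ⟩ , y″ , ≈-refl , SolD-resp extQ (≈-sym w≈z) ≈-refl tree ,
            v″ , app-c″ , sy″)
      where
      x z″ y″ : Baire
      x = π₁ (tailᴮ o)
      z″ = π₁ (tailᴮ o′)
      y″ = π₂ (tailᴮ o′)
      z′≈z″ : z′ ≈ z″
      z′≈z″ = proj₁ (in₂-components o′≈ q≈)
      tree : SolD Q z ⟨ x , z″ ⟩
      tree = sstep z0≡1 sx app-d (SolD-resp extQ (π₁π₂-residual w x dx) z′≈z″ S) ≈-refl
      cont : π₂ (π₂ w) · ⟨ x , z″ ⟩ ∈ dom P
      cont = proj₂ (proj₂ inst) ⟨ x , z″ ⟩ tree
      v″ : Baire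
      v″ = proj₁ cont
      app-c″ : App (π₂ (π₂ w)) ⟨ x , z″ ⟩ v″
      app-c″ = proj₁ (proj₂ cont)
      sy″ : sol P v″ y″
      sy″ = proj₂ extP
        (App-functional {continuation w x} {z″}
          (App-resp {π₂ (π₂ (residual w x dx))} {continuation w x} {z′} {z″} {v} (π₂π₂-residual w x dx) z′≈z″ ≈-refl app-c)
          (App-continuation w x z″ v″ app-c″))
        (proj₂ (in₂-components o′≈ q≈)) sy′

    from-b : ∀ y o → App b ⟨ W , y ⟩ o → sol (R ⊓ (P ⋆ Q)) W o → backward w · y ∈ sol (R ⊓ (P ⋆ (Q ◇))) w
    from-b y o app-b (inj₁ (r , o≈ , sr)) =
      o , backward-in₁ w y o step app-b (o≈ 0) , inj₁ (r , o≈ , proj₂ extR (π₁-⟨,⟩ (π₁ w) _) ≈-refl sr)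
    from-b y o app-b (inj₂ (q , o≈ , x , y₁ , q≈ , sx , v-sub , app-v-sub , sy₁)) = descend (sub x′ sx′)
      where
      x′ y₁′ : Baire
      x′ = π₁ (tailᴮ o)
      y₁′ = π₂ (tailᴮ o)
      sx′ : sol Q (π₁ z) x′
      sx′ = proj₂ extQ W≈z (proj₁ (in₂-components o≈ q≈)) sx
      descend : (Σ Baire λ dx → App (π₂ z) x′ dx × (∀ w′ → InstanceAt dx w′ → Handled w′)) →
                backward w · y ∈ sol (R ⊓ (P ⋆ (Q ◇))) w
      descend (dx , app-d , handled) = answer (handled (residual w x′ dx) (residual-instance x′ dx sx′ app-d))
        where
        sy₁′ : ∀ {vr} → App A (residual w x′ dx) vr → sol P vr y₁′
        sy₁′ {vr} app-A = proj₂ extP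
          (App-functional {subproblems A w} {x′}
            (App-resp {π₂ (π₂ W)} {subproblems A w} {x} {x′} {v-sub}
                      (π₂π₂-reducedInstance A w) (proj₁ (in₂-components o≈ q≈)) ≈-refl app-v-sub)
            (App-subproblems A w x′ dx vr (App-d app-d) app-A))
          (proj₂ (in₂-components o≈ q≈)) sy₁
        answer : Handled (residual w x′ dx) → backward w · y ∈ sol (R ⊓ (P ⋆ (Q ◇))) w
        answer ((vr , app-A , _) , backward-ok) =
          from-residual y o dx app-b (o≈ 0) sx′ app-d (backward-ok vr app-A y₁′ (sy₁′ app-A))

    handled-step : Handled w
    handled-step = (v , app-A , dom-v) , backward-ok
      where
      v : Baire
      v = proj₁ (proj₁ red W W-dom)
      app-a : App a W v
      app-a = proj₁ (proj₂ (proj₁ red W W-dom))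
      dom-v : dom P v
      dom-v = proj₂ (proj₂ (proj₁ red W W-dom))
      app-A : App A w v
      app-A = A-step w v step app-a
      answer : ∀ y → b · ⟨ W , y ⟩ ∈ sol (R ⊓ (P ⋆ Q)) W → backward w · y ∈ sol (R ⊓ (P ⋆ (Q ◇))) w
      answer y (o , app-b , so) = from-b y o app-b so
      backward-ok : ∀ v′ → App A w v′ → ∀ y → sol P v′ y → backward w · y ∈ sol (R ⊓ (P ⋆ (Q ◇))) w
      backward-ok v′ app-A′ y sy = answer y (proj₂ red W W-dom v app-a y sy′)
        where
        sy′ : sol P v y
        sy′ = proj₂ extP (App-functional {A} {w} app-A′ app-A) ≈-refl sy

  handled : ∀ {z} → DomD Q z → ∀ w → InstanceAt z w → Handled w
  handled     (d• z≈•)              w inst = handled-root w z≈• inst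
  handled {z} (dstep z0≡1 dom-u next) w inst = Step.handled-step w z0≡1 dom-u sub inst
    where
    sub : ∀ x → sol Q (π₁ z) x → Σ Baire λ dx → App (π₂ z) x dx × (∀ w′ → InstanceAt dx w′ → Handled w′)
    sub x sx with next x sx
    ... | dx , app-d , D = dx , app-d , handled D

  iteration-witnesses : Witnesses (R ⊓ (P ⋆ (Q ◇))) P A b′
  iteration-witnesses = (λ u dom-u → proj₁ (handled-instance u dom-u)) , backward-ok
    where
    handled-instance : ∀ u → dom (R ⊓ (P ⋆ (Q ◇))) u → Handled u
    handled-instance u (_ , dom-r , _ , D , cont) = handled D u (≈-refl , dom-r , cont)
    backward-ok : ∀ u → dom (R ⊓ (P ⋆ (Q ◇))) u → ∀ v → App A u v → ∀ y → sol P v y →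
                  b′ · ⟨ u , y ⟩ ∈ sol (R ⊓ (P ⋆ (Q ◇))) u
    backward-ok u dom-u v app-A y sy with proj₂ (handled-instance u dom-u) v app-A y sy
    ... | r , app-r , sr = r , b′-backward u y r app-r , sr

-- Context: w , D , p where p = ⟨ a , b ⟩ and D · D is the forward code itself.
forwardBody : Term 3
forwardBody = ifZero (π₁ᵗ (π₂ᵗ v₀)) (π₂ᵗ (π₂ᵗ v₀) ∙ con •)
                     (π₁ᵗ v₃ ∙ (weaken reducedInstanceᵗ ∙ (v₂ ∙ v₂) ∙ v₀)) v₀

forwardᵗ : Term 1
forwardᵗ = fix forwardBody

-- Context: o′ , o , w , y , w , D , p.
combinedAnswer : Term 7
combinedAnswer = in₂ᵗ ⟨ ⟨ π₁ᵗ (tailᵗ v₁) , π₁ᵗ (tailᵗ v₀) ⟩ᵗ , π₂ᵗ (tailᵗ v₀) ⟩ᵗ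

-- Context: o , w , y , w , D , p, where o = b · ⟨ reducedInstance A w , y ⟩ and D · D is the backward code.
residualAnswer : Term 6
residualAnswer = (v₄ ∙ v₄) ∙ (weaken residualᵗ ∙ v₁ ∙ π₁ᵗ (tailᵗ v₀)) ∙ π₂ᵗ (tailᵗ v₀)

-- Context: w , y , w , D , p.
answerOfB : Term 5
answerOfB = π₂ᵗ v₄ ∙ ⟨ weaken reducedInstanceᵗ ∙ rename (const (suc (suc (suc (suc zero))))) forwardᵗ ∙ v₀ , v₁ ⟩ᵗ

-- Context: y , w , D , p.
backwardBody : Term 4
backwardBody = ifZero (π₁ᵗ (π₂ᵗ v₁)) (in₂ᵗ ⟨ con • , v₁ ⟩ᵗ)
                      (ifZero answerOfB v₀ (ifZero residualAnswer v₀ combinedAnswer residualAnswer) answerOfB) v₁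

backwardᵗ : Term 1
backwardᵗ = fix (ƛ backwardBody)

-- Context: q , p.
b′Body : Term 2
b′Body = rename (const (suc zero)) backwardᵗ ∙ π₁ᵗ v₀ ∙ π₂ᵗ v₀

iterationBody : Term 1
iterationBody = ⟨ forwardᵗ , ƛ b′Body ⟩ᵗ

iterationᶜ : Baire
iterationᶜ = proj₁ (ƛ-sound iterationBody [])

module Construction (a b : Baire) where

  p : Baire
  p = ⟨ a , b ⟩

  private
    forwardFix : Σ Baire λ D → Σ Baire λ A → Ev (p ∷ []) forwardᵗ A × App D D A ×
                 (∀ w y → Ev (w ∷ D ∷ p ∷ []) forwardBody y → App A w y)
    forwardFix = fix-sound forwardBody (p ∷ [])

    backwardFix : Σ Baire λ D → Σ Baire λ Ψ → Ev (p ∷ []) backwardᵗ Ψ × App D D Ψ ×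
                  (∀ w F → Ev (w ∷ D ∷ p ∷ []) (ƛ backwardBody) F → App Ψ w F)
    backwardFix = fix-sound (ƛ backwardBody) (p ∷ [])

  Dᶠ A : Baire
  Dᶠ = proj₁ forwardFix
  A = proj₁ (proj₂ forwardFix)

  ev-A : Ev (p ∷ []) forwardᵗ A
  ev-A = proj₁ (proj₂ (proj₂ forwardFix))

  Dᵇ Ψ : Baire
  Dᵇ = proj₁ backwardFix
  Ψ = proj₁ (proj₂ backwardFix)

  ev-Ψ : Ev (p ∷ []) backwardᵗ Ψ
  ev-Ψ = proj₁ (proj₂ (proj₂ backwardFix))

  backward : Baire → Baire
  backward w = proj₁ (ƛ-sound backwardBody (w ∷ Dᵇ ∷ p ∷ []))

  App-Ψ : ∀ w → App Ψ w (backward w)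
  App-Ψ w = proj₂ (proj₂ (proj₂ (proj₂ backwardFix))) w (backward w) (proj₁ (proj₂ (ƛ-sound backwardBody (w ∷ Dᵇ ∷ p ∷ []))))

  b′ : Baire
  b′ = proj₁ (ƛ-sound b′Body (p ∷ []))

  App-iterationᶜ : App iterationᶜ ⟨ a , b ⟩ ⟨ A , b′ ⟩
  App-iterationᶜ = proj₂ (proj₂ (ƛ-sound iterationBody [])) p ⟨ A , b′ ⟩
                          (ev-⟨,⟩ ev-A (proj₁ (proj₂ (ƛ-sound b′Body (p ∷ [])))))

  private
    App-π₁p : ∀ {u v} → App a u v → App (π₁ p) u v
    App-π₁p {u} {v} = App-resp {a} {π₁ p} {u} {u} {v} (≈-sym (π₁-⟨,⟩ a b)) ≈-refl ≈-refl

    App-π₂p : ∀ {u v} → App b u v → App (π₂ p) u v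
    App-π₂p {u} {v} = App-resp {b} {π₂ p} {u} {u} {v} (≈-sym (π₂-⟨,⟩ a b)) ≈-refl ≈-refl

    A-spec : ∀ w y → Ev (w ∷ Dᶠ ∷ p ∷ []) forwardBody y → App A w y
    A-spec = proj₂ (proj₂ (proj₂ (proj₂ forwardFix)))

    backward-spec : ∀ w y r → Ev (y ∷ w ∷ Dᵇ ∷ p ∷ []) backwardBody r → App (backward w) y r
    backward-spec w = proj₂ (proj₂ (ƛ-sound backwardBody (w ∷ Dᵇ ∷ p ∷ [])))

    ev-answerOfB : ∀ {w y o} → App b ⟨ reducedInstance A w , y ⟩ o → Ev (w ∷ y ∷ w ∷ Dᵇ ∷ p ∷ []) answerOfB o
    ev-answerOfB app-b = ev-app (ev-π₂ ev-lookup)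
      (ev-⟨,⟩ (ev-reducedInstance (Ev-rename (const (suc (suc (suc (suc zero))))) (λ { zero → ≈-refl }) ev-A) ev-lookup)
              ev-lookup)
      (applies (App-π₂p app-b))

    ev-residualAnswer : ∀ {w y o dx o′} → App (π₂ (π₁ (π₂ w))) (π₁ (tailᴮ o)) dx →
                        App (backward (residual w (π₁ (tailᴮ o)) dx)) (π₂ (tailᴮ o)) o′ →
                        Ev (o ∷ w ∷ y ∷ w ∷ Dᵇ ∷ p ∷ []) residualAnswer o′
    ev-residualAnswer app-d app-o′ =
      ev-app (ev-app (ev-app ev-lookup ev-lookup (applies (proj₁ (proj₂ (proj₂ (proj₂ backwardFix))))))
                     (ev-residual app-d ev-lookup (ev-π₁ (ev-tail ev-lookup))) (applies (App-Ψ _)))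
             (ev-π₂ (ev-tail ev-lookup)) (applies app-o′)

  iteration : Iteration a b A b′
  Iteration.backward iteration = backward
  Iteration.b′-backward iteration u y r app = proj₂ (proj₂ (ƛ-sound b′Body (p ∷ []))) ⟨ u , y ⟩ r
    (ev-app (ev-app (Ev-rename (const (suc zero)) (λ { zero → ≈-refl }) ev-Ψ) (ev-π₁ ev-lookup)
                    (applies (App-resp {Ψ} {Ψ} {u} {π₁ ⟨ u , y ⟩} {backward u} ≈-refl (≈-sym (π₁-⟨,⟩ u y)) ≈-refl (App-Ψ u))))
            (ev-π₂ ev-lookup)
            (applies (App-resp {backward u} {backward u} {y} {π₂ ⟨ u , y ⟩} {r} ≈-refl (≈-sym (π₂-⟨,⟩ u y)) ≈-refl app)))
  Iteration.A-root iteration w v root app-c = A-spec w v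
    (ev-ifZero-zero (ev-π₁ (ev-π₂ ev-lookup)) root ev-lookup (ev-app (ev-π₂ (ev-π₂ ev-lookup)) ev-const (applies app-c)))
  Iteration.A-step iteration w v step app-a = A-spec w v
    (ev-ifZero-suc (ev-π₁ (ev-π₂ ev-lookup)) step ev-lookup
      (ev-app (ev-π₁ ev-lookup)
              (ev-reducedInstance (ev-app ev-lookup ev-lookup (applies (proj₁ (proj₂ (proj₂ (proj₂ forwardFix)))))) ev-lookup)
              (applies (App-π₁p app-a))))
  Iteration.backward-root iteration w y root = backward-spec w y _
    (ev-ifZero-zero (ev-π₁ (ev-π₂ ev-lookup)) root ev-lookup (ev-in₂ (ev-⟨,⟩ ev-const ev-lookup)))
  Iteration.backward-in₁ iteration w y o step app-b o-in₁ = backward-spec w y o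
    (ev-ifZero-suc (ev-π₁ (ev-π₂ ev-lookup)) step ev-lookup
      (ev-ifZero-zero (ev-answerOfB app-b) o-in₁ (ev-answerOfB app-b) ev-lookup))
  Iteration.backward-in₂-in₁ iteration w y o dx o′ step app-b o-in₂ app-d app-o′ o′-in₁ = backward-spec w y o′
    (ev-ifZero-suc (ev-π₁ (ev-π₂ ev-lookup)) step ev-lookup
      (ev-ifZero-suc (ev-answerOfB app-b) o-in₂ (ev-answerOfB app-b)
        (ev-ifZero-zero (ev-residualAnswer app-d app-o′) o′-in₁ (ev-residualAnswer app-d app-o′) ev-lookup)))
  Iteration.backward-in₂-in₂ iteration w y o dx o′ step app-b o-in₂ app-d app-o′ o′-in₂ = backward-spec w y _
    (ev-ifZero-suc (ev-π₁ (ev-π₂ ev-lookup)) step ev-lookup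
      (ev-ifZero-suc (ev-answerOfB app-b) o-in₂ (ev-answerOfB app-b)
        (ev-ifZero-suc (ev-residualAnswer app-d app-o′) o′-in₂ (ev-residualAnswer app-d app-o′)
          (ev-in₂ (ev-⟨,⟩ (ev-⟨,⟩ (ev-π₁ (ev-tail ev-lookup)) (ev-π₁ (ev-tail ev-lookup))) (ev-π₂ (ev-tail ev-lookup)))))))

Computable-⟨,⟩ : ∀ {x y} → Computable x → Computable y → Computable ⟨ x , y ⟩
Computable-⟨,⟩ {x} {y} x-computable y-computable =
  Computable-App (Computable-App (Recursive₁⇒Computable pairᶜ-recursive) x-computable (App-pair x)) y-computable (App-pairWith x y)

Computable-π₁ : ∀ {w} → Computable w → Computable (π₁ w)
Computable-π₁ {w} w-computable = Computable-App (Recursive₁⇒Computable π₁ᶜ-recursive) w-computable (App-π₁ w)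

Computable-π₂ : ∀ {w} → Computable w → Computable (π₂ w)
Computable-π₂ {w} w-computable = Computable-App (Recursive₁⇒Computable π₂ᶜ-recursive) w-computable (App-π₂ w)

module _ {n : ℕ} where

  cc-π₁ : ∀ {t : Term n} → ComputableConstants t → ComputableConstants (π₁ᵗ t)
  cc-π₁ = cc-app (cc-con (Recursive₁⇒Computable π₁ᶜ-recursive))

  cc-π₂ : ∀ {t : Term n} → ComputableConstants t → ComputableConstants (π₂ᵗ t)
  cc-π₂ = cc-app (cc-con (Recursive₁⇒Computable π₂ᶜ-recursive))

  cc-tail : ∀ {t : Term n} → ComputableConstants t → ComputableConstants (tailᵗ t)
  cc-tail = cc-app (cc-con (Recursive₁⇒Computable tailᶜ-recursive))

  cc-in₂ : ∀ {t : Term n} → ComputableConstants t → ComputableConstants (in₂ᵗ t)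
  cc-in₂ = cc-app (cc-con (Recursive₁⇒Computable in₂ᶜ-recursive))

  cc-⟨,⟩ : ∀ {t u : Term n} → ComputableConstants t → ComputableConstants u → ComputableConstants ⟨ t , u ⟩ᵗ
  cc-⟨,⟩ ct cu = cc-app (cc-app (cc-con (Recursive₁⇒Computable pairᶜ-recursive)) ct) cu

  cc-ifZero : ∀ {tz tw : Term n} {t₁ t₂} → ComputableConstants tz → ComputableConstants t₁ → ComputableConstants t₂ →
              ComputableConstants tw → ComputableConstants (ifZero tz t₁ t₂ tw)
  cc-ifZero {t₁ = t₁} {t₂} cz c₁ c₂ cw =
    cc-app (cc-app (cc-app (cc-app (cc-con (Recursive₁⇒Computable selectᶜ-recursive)) cz) (ƛ-computable t₁ c₁))
                   (ƛ-computable t₂ c₂))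
           cw

  cc-weaken : ∀ (t : Term 0) → ComputableConstants t → ComputableConstants {n} (weaken t)
  cc-weaken = weaken-computable

cc-ƛ² : ∀ {n} (t : Term (2 + n)) → ComputableConstants t → ComputableConstants (ƛ (ƛ t))
cc-ƛ² t ct = ƛ-computable _ (ƛ-computable t ct)

cc-ƛ³ : ∀ {n} (t : Term (3 + n)) → ComputableConstants t → ComputableConstants (ƛ (ƛ (ƛ t)))
cc-ƛ³ t ct = ƛ-computable _ (cc-ƛ² t ct)

cc-continuationᵗ : ComputableConstants continuationᵗ
cc-continuationᵗ = cc-ƛ³ _ (cc-app (cc-π₂ (cc-π₂ cc-var)) (cc-⟨,⟩ cc-var cc-var))

cc-residualᵗ : ComputableConstants residualᵗ
cc-residualᵗ = cc-ƛ² _ (cc-⟨,⟩ (cc-π₁ cc-var)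
  (cc-⟨,⟩ (cc-app (cc-π₂ (cc-π₁ (cc-π₂ cc-var))) cc-var) (cc-app (cc-app (cc-weaken _ cc-continuationᵗ) cc-var) cc-var)))

cc-subproblemsᵗ : ComputableConstants subproblemsᵗ
cc-subproblemsᵗ = cc-ƛ³ _ (cc-app cc-var (cc-app (cc-app (cc-weaken _ cc-residualᵗ) cc-var) cc-var))

cc-reducedInstanceᵗ : ComputableConstants reducedInstanceᵗ
cc-reducedInstanceᵗ = cc-ƛ² _ (cc-⟨,⟩ (cc-π₁ cc-var)
  (cc-⟨,⟩ (cc-π₁ (cc-π₁ (cc-π₂ cc-var))) (cc-app (cc-app (cc-weaken _ cc-subproblemsᵗ) cc-var) cc-var)))

cc-forwardᵗ : ComputableConstants forwardᵗ
cc-forwardᵗ = fix-computable _ (cc-ifZero (cc-π₁ (cc-π₂ cc-var))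
  (cc-app (cc-π₂ (cc-π₂ cc-var)) (cc-con •-computable))
  (cc-app (cc-π₁ cc-var) (cc-app (cc-app (cc-weaken _ cc-reducedInstanceᵗ) (cc-app cc-var cc-var)) cc-var))
  cc-var)

cc-backwardᵗ : ComputableConstants backwardᵗ
cc-backwardᵗ = fix-computable _ (ƛ-computable _ (cc-ifZero (cc-π₁ (cc-π₂ cc-var)) (cc-in₂ (cc-⟨,⟩ (cc-con •-computable) cc-var))
  (cc-ifZero cc-answerOfB cc-var (cc-ifZero cc-residualAnswer cc-var cc-combinedAnswer cc-residualAnswer) cc-answerOfB) cc-var))
  where
  cc-answerOfB : ComputableConstants answerOfB
  cc-answerOfB = cc-app (cc-π₂ cc-var)
    (cc-⟨,⟩ (cc-app (cc-app (cc-weaken _ cc-reducedInstanceᵗ) (rename-computable _ forwardᵗ cc-forwardᵗ)) cc-var) cc-var)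
  cc-residualAnswer : ComputableConstants residualAnswer
  cc-residualAnswer = cc-app (cc-app (cc-app cc-var cc-var) (cc-app (cc-app (cc-weaken _ cc-residualᵗ) cc-var) (cc-π₁ (cc-tail cc-var))))
                             (cc-π₂ (cc-tail cc-var))
  cc-combinedAnswer : ComputableConstants combinedAnswer
  cc-combinedAnswer = cc-in₂ (cc-⟨,⟩ (cc-⟨,⟩ (cc-π₁ (cc-tail cc-var)) (cc-π₁ (cc-tail cc-var))) (cc-π₂ (cc-tail cc-var)))

iterationᶜ-computable : Computable iterationᶜ
iterationᶜ-computable = Ev-closed-computable
  (ƛ-computable iterationBody (cc-⟨,⟩ cc-forwardᵗ (ƛ-computable b′Body
    (cc-app (cc-app (rename-computable _ backwardᵗ cc-backwardᵗ) (cc-π₁ cc-var)) (cc-π₂ cc-var)))))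
  (proj₁ (proj₂ (ƛ-sound iterationBody [])))

lemma2p4 : (P Q R : Problem) → IsExt P → IsExt Q → IsExt R →
    ((R ⊓ (P ⋆ Q)) ≤W P → (R ⊓ (P ⋆ (Q ◇))) ≤W P) ×
    (Σ Baire λ f → Computable f × (∀ a b → Witnesses (R ⊓ (P ⋆ Q)) P a b →
      Σ Baire λ a' → Σ Baire λ b' →
        App f ⟨ a , b ⟩ ⟨ a' , b' ⟩ × Witnesses (R ⊓ (P ⋆ (Q ◇))) P a' b'))
lemma2p4 P Q R extP extQ extR = nonuniform , iterationᶜ , iterationᶜ-computable , uniform
  where
  uniform : ∀ a b → Witnesses (R ⊓ (P ⋆ Q)) P a b →
            Σ Baire λ A → Σ Baire λ b′ → App iterationᶜ ⟨ a , b ⟩ ⟨ A , b′ ⟩ × Witnesses (R ⊓ (P ⋆ (Q ◇))) P A b′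
  uniform a b red = A , b′ , App-iterationᶜ , Correctness.iteration-witnesses P Q R extP extQ extR iteration red
    where open Construction a b
  nonuniform : (R ⊓ (P ⋆ Q)) ≤W P → (R ⊓ (P ⋆ (Q ◇))) ≤W P
  nonuniform (a , b , a-computable , b-computable , red) =
    A , b′ , Computable-resp (Computable-π₁ codes-computable) (π₁-⟨,⟩ A b′) ,
             Computable-resp (Computable-π₂ codes-computable) (π₂-⟨,⟩ A b′) ,
             Correctness.iteration-witnesses P Q R extP extQ extR iteration red
    where
    open Construction a b
    codes-computable : Computable ⟨ A , b′ ⟩
    codes-computable = Computable-App iterationᶜ-computable (Computable-⟨,⟩ a-computable b-computable) App-iterationᶜ
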